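{- Let $\mathcal S$ be a generalized KM-arc of type $(0,m,t)$ in a projective plane $\Pi_q$ of order $q$. Then: (1) if $t=q+1$, then $\mathcal S$ is a line; (2) if $t=q$, then $\mathcal S$ is the union of $m$ concurrent lines with their common point $P$ removed; (3) if $m=q+1$, then $\mathcal S$ is the complement of a point; (4) if $m=q$ and $q$ is a prime power, then $\mathcal S$ is the complement of a Baer subplane, or $\mathcal S$ is an affine plane of order $q$ (i.e. the complement of a line) with at most one of its points removed; (5) if $m=1$, then $\mathcal S$ is a subset of a line.
   Context: A generalized KM-arc of type $(0,m,t)$ in a projective plane of order $q$ is a proper non-empty subset $\mathcal S$ of the points with $|\mathcal S|=q(m-1)+t$ such that every line meets $\mathcal S$ in $0$, $m$ or $t$ points. A Baer subplane is a subplane of order $\sqrt q$. -}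

module Defs where

open import Data.Nat using (ℕ; zero; suc; _+_; _*_; _^_; _≥_)
open import Data.Nat.Primality using (Prime)
open import Data.Bool using (Bool; true; false; _∧_; if_then_else_)
open import Data.Fin using (Fin)
open import Data.Product using (Σ; _×_; ∃; ∃-syntax)
open import Data.Sum using (_⊎_)
open import Relation.Binary.PropositionalEquality using (_≡_; _≢_)
open import Relation.Nullary using (¬_)
open import Function using (_∘_)
open import Function.Bundles using (_⇔_)

count : ∀ {n} → (Fin n → Bool) → ℕ
count {zero}  f = 0
count {suc n} f = (if f Fin.zero then 1 else 0) + count (f ∘ Fin.suc)

Incidence : ℕ → ℕ → Set
Incidence np nl = Fin np → Fin nl → Bool

module _ {np nl : ℕ} (I : Incidence np nl) where

  record IsProjectivePlaneOn (P : Fin np → Bool) (L : Fin nl → Bool) (n : ℕ) : Set where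
    field
      joins : ∀ p p' → P p ≡ true → P p' ≡ true → p ≢ p' →
              Σ (Fin nl) λ l → (L l ≡ true × I p l ≡ true × I p' l ≡ true) ×
                (∀ l' → L l' ≡ true → I p l' ≡ true → I p' l' ≡ true → l' ≡ l)
      meets : ∀ l l' → L l ≡ true → L l' ≡ true → l ≢ l' →
              Σ (Fin np) λ p → (P p ≡ true × I p l ≡ true × I p l' ≡ true) ×
                (∀ p' → P p' ≡ true → I p' l ≡ true → I p' l' ≡ true → p' ≡ p)
      quadrangle : Σ (Fin 4 → Fin np) λ f →
                   (∀ i → P (f i) ≡ true) ×
                   (∀ i j → i ≢ j → f i ≢ f j) ×
                   (∀ i j k → i ≢ j → i ≢ k → j ≢ k → ∀ l → L l ≡ true →
                      ¬ (I (f i) l ≡ true × I (f j) l ≡ true × I (f k) l ≡ true))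
      order : ∀ l → L l ≡ true → count (λ p → P p ∧ I p l) ≡ suc n

  IsProjectivePlane : ℕ → Set
  IsProjectivePlane q = IsProjectivePlaneOn (λ _ → true) (λ _ → true) q

  -- Generalized KM-arc of type (0,m,t) in a plane of order q:
  -- proper non-empty point set S with |S| = q(m-1)+t (stated as |S| + q = qm + t
  -- to avoid truncated subtraction), every line meeting S in 0, m or t points.
  record IsGenKMArc (q m t : ℕ) (S : Fin np → Bool) : Set where
    field
      nonempty : ∃[ p ] S p ≡ true
      proper   : ∃[ p ] S p ≡ false
      size     : count S + q ≡ q * m + t
      lineType : ∀ l → let c = count (λ p → S p ∧ I p l) in
                 c ≡ 0 ⊎ c ≡ m ⊎ c ≡ t

  IsBaerSubplanePoints : ℕ → (Fin np → Bool) → Set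
  IsBaerSubplanePoints q B =
    Σ (Fin nl → Bool) λ L → Σ ℕ λ r → r * r ≡ q × IsProjectivePlaneOn B L r

  IsLine : (Fin np → Bool) → Set
  IsLine S = ∃[ l ] (∀ p → S p ≡ true ⇔ I p l ≡ true)

  IsConcurrentLinesMinusPoint : ℕ → (Fin np → Bool) → Set
  IsConcurrentLinesMinusPoint m S =
    Σ (Fin np) λ P → Σ (Fin m → Fin nl) λ ls →
      (∀ i j → ls i ≡ ls j → i ≡ j) ×
      (∀ i → I P (ls i) ≡ true) ×
      (∀ p → S p ≡ true ⇔ (p ≢ P × ∃[ i ] I p (ls i) ≡ true))

  IsPointComplement : (Fin np → Bool) → Set
  IsPointComplement S = ∃[ P ] (∀ p → S p ≡ true ⇔ p ≢ P)

  IsBaerComplement : ℕ → (Fin np → Bool) → Set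
  IsBaerComplement q S = Σ (Fin np → Bool) λ B →
    IsBaerSubplanePoints q B × (∀ p → S p ≡ true ⇔ B p ≡ false)

  IsAffineMinusAtMostOnePoint : (Fin np → Bool) → Set
  IsAffineMinusAtMostOnePoint S = ∃[ l ]
    ((∀ p → S p ≡ true ⇔ I p l ≡ false) ⊎
     (∃[ Q ] (I Q l ≡ false × (∀ p → S p ≡ true ⇔ (I p l ≡ false × p ≢ Q)))))

  IsSubsetOfLine : (Fin np → Bool) → Set
  IsSubsetOfLine S = ∃[ l ] (∀ p → S p ≡ true → I p l ≡ true)

IsPrimePower : ℕ → Set
IsPrimePower q = Σ ℕ λ p → Σ ℕ λ k → Prime p × k ≥ 1 × q ≡ p ^ k

-- Everything rests on double counting incidences: for a point P and a point set H, summing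
-- |H ∩ l| over the q + 1 lines l through P gives |H| + q·[P ∈ H]. At a point of S, on which
-- a t-lines and b m-lines meet with a + b = q + 1, this reads t a + m b = q m + t, so for
-- m ≠ t every point of S lies on exactly one t-line; at a point off S it bounds |S| by the
-- sizes of the lines through that point.
-- (1) The t-line through a point of S is then full, and any other t-line would meet it in a
-- point of S, so it is S. (2) If m = t = q, two points off S span a 0-line, which carries
-- the whole complement of S; otherwise there are |S|/t = m t-lines and they all pass through
-- the unique point off S on any one of them. (3) The bounds at a point off S force t = q and
-- |S| = q² + q. (4) A 0-line ℓ together with a point Y off S ∪ ℓ forces t = q - 1 and
-- Sᶜ = ℓ ∪ {Y}. Without 0-lines, the points off S and the t-lines form a subplane, and
-- counting S along the lines through a point off a t-line shows that its order r has r² = q.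
-- (5) A line through two points of S is a t-line, so it contains all t = |S| of them.

module Submission where

open import Defs
open import Data.Nat using (ℕ; zero; suc; pred; _+_; _*_; _≤_; _<_; z≤n; s≤s; _≟_; NonZero; >-nonZero)
open import Data.Nat.Properties
open import Data.Nat.Tactic.RingSolver using (solve-∀)
open import Data.Bool using (Bool; true; false; _∧_; not; if_then_else_) renaming (_≟_ to _≟ᵇ_)
open import Data.Bool.Properties using (∧-conicalˡ; ∧-conicalʳ; ∧-comm; ∧-zeroʳ; ∧-identityʳ; ∧-idem; ¬-not; not-¬)
open import Data.Fin using (Fin) renaming (zero to fzero; suc to fsuc)
open import Data.Fin.Patterns using (0F; 1F; 2F; 3F)
import Data.Fin.Properties as Fin
open import Data.Product using (Σ; _×_; _,_; proj₁; proj₂; map; ∃-syntax)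
open import Data.Sum using (_⊎_; inj₁; inj₂)
open import Data.Empty using (⊥)
open import Relation.Nullary using (¬_; Dec; yes; no; does; contradiction)
open import Relation.Nullary.Decidable using (dec-true; dec-false; decidable-stable)
open import Relation.Binary.PropositionalEquality
  using (_≡_; _≢_; refl; sym; trans; cong; cong₂; subst; module ≡-Reasoning)
open import Function using (_∘_; const; id)
open import Function.Bundles using (_⇔_; mk⇔; Equivalence)
open import Data.Vec using ([]; _∷_; lookup)
import Data.Vec.Functional as Vector
open import Data.Vec.Relation.Unary.All using (All; []; _∷_)
open import Data.Vec.Relation.Unary.All.Properties using (lookup⁺)
open import Data.Vec.Relation.Unary.Unique.Propositional using (Unique; []; _∷_)
open import Data.Vec.Relation.Unary.Unique.Propositional.Properties using (lookup-injective)
open import Algebra.Properties.CommutativeMonoid.Sum +-0-commutativeMonoid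
  using (sum; sum-syntax; ∑-comm; ∑-distrib-+; sum-cong-≗; sum-replicate-zero)

∧-intro : ∀ {a b} → a ≡ true → b ≡ true → a ∧ b ≡ true
∧-intro refl refl = refl

∧-elimˡ : ∀ {a b} → a ∧ b ≡ true → a ≡ true
∧-elimˡ = ∧-conicalˡ _ _

∧-elimʳ : ∀ {a b} → a ∧ b ≡ true → b ≡ true
∧-elimʳ = ∧-conicalʳ _ _

not-intro : ∀ {a} → a ≡ false → not a ≡ true
not-intro refl = refl

not-elim : ∀ {a} → not a ≡ true → a ≡ false
not-elim {false} _ = refl

≢true⇒≡false : ∀ {a} → a ≢ true → a ≡ false
≢true⇒≡false = ¬-not

≢false⇒≡true : ∀ {a} → a ≢ false → a ≡ true
≢false⇒≡true = ¬-not

≡false⇒≢true : ∀ {a} → a ≡ false → a ≢ true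
≡false⇒≢true = not-¬

does≡true⇒ : ∀ {A : Set} (a? : Dec A) → does a? ≡ true → A
does≡true⇒ (yes a) _ = a

_==_ : ∀ {n} → Fin n → Fin n → Bool
x == y = does (x Fin.≟ y)

χ : Bool → ℕ
χ b = if b then 1 else 0

_⊆_ : ∀ {n} → (Fin n → Bool) → (Fin n → Bool) → Set
f ⊆ g = ∀ x → f x ≡ true → g x ≡ true

_∖_ : ∀ {n} → (Fin n → Bool) → Fin n → Fin n → Bool
(f ∖ p) x = f x ∧ not (x == p)

∖-intro : ∀ {n} (f : Fin n → Bool) {p x} → f x ≡ true → x ≢ p → (f ∖ p) x ≡ true
∖-intro f fx x≢p = ∧-intro fx (not-intro (dec-false (_ Fin.≟ _) x≢p))

∖-elim : ∀ {n} (f : Fin n → Bool) {p x} → (f ∖ p) x ≡ true → f x ≡ true × x ≢ p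
∖-elim f {p} {x} e = ∧-elimˡ e , λ x≡p → ≡false⇒≢true (not-elim (∧-elimʳ e)) (dec-true (x Fin.≟ p) x≡p)

true-somewhere? : ∀ {n} (f : Fin n → Bool) → (∃[ x ] f x ≡ true) ⊎ (∀ x → f x ≡ false)
true-somewhere? f with Fin.any? (λ x → f x ≟ᵇ true)
... | yes found = inj₁ found
... | no none = inj₂ (λ x → ≢true⇒≡false (λ fx → none (x , fx)))

count-cong : ∀ {n} {f g : Fin n → Bool} → (∀ x → f x ≡ g x) → count f ≡ count g
count-cong {zero} _ = refl
count-cong {suc n} f≗g = cong₂ _+_ (cong χ (f≗g fzero)) (count-cong (f≗g ∘ fsuc))

count-none : ∀ {n} {f : Fin n → Bool} → (∀ x → f x ≡ false) → count f ≡ 0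
count-none {zero} _ = refl
count-none {suc n} none rewrite none fzero = count-none (none ∘ fsuc)

count-const-true : ∀ n → count {n} (const true) ≡ n
count-const-true zero = refl
count-const-true (suc n) = cong suc (count-const-true n)

count-split : ∀ {n} (f g : Fin n → Bool) →
              count f ≡ count (λ x → f x ∧ g x) + count (λ x → f x ∧ not (g x))
count-split {zero} f g = refl
count-split {suc n} f g with f fzero | g fzero
... | true  | true  = cong suc (count-split (f ∘ fsuc) (g ∘ fsuc))
... | true  | false = trans (cong suc (count-split (f ∘ fsuc) (g ∘ fsuc))) (sym (+-suc _ _))
... | false | _     = count-split (f ∘ fsuc) (g ∘ fsuc)

count-complement : ∀ {n} (f : Fin n → Bool) → count f + count (not ∘ f) ≡ n
count-complement {n} f = trans (sym (count-split (const true) f)) (count-const-true n)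

count-⊆ : ∀ {n} {f g : Fin n → Bool} → f ⊆ g → count g ≡ count f + count (λ x → g x ∧ not (f x))
count-⊆ {f = f} {g} f⊆g = trans (count-split g f) (cong (_+ count (λ x → g x ∧ not (f x))) (count-cong g∧f≡f))
  where
  g∧f≡f : ∀ x → g x ∧ f x ≡ f x
  g∧f≡f x with f x in fx
  ... | true  = cong (_∧ true) (f⊆g x fx)
  ... | false = ∧-zeroʳ (g x)

true⇒1≤count : ∀ {n} (f : Fin n → Bool) {x} → f x ≡ true → 1 ≤ count f
true⇒1≤count f {fzero} fx rewrite fx = s≤s z≤n
true⇒1≤count f {fsuc x} fx = ≤-trans (true⇒1≤count (f ∘ fsuc) fx) (m≤n+m _ _)

count≡0⇒false : ∀ {n} (f : Fin n → Bool) → count f ≡ 0 → ∀ x → f x ≡ false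
count≡0⇒false f c≡0 x = ≢true⇒≡false (λ fx → 1+n≰n (≤-trans (true⇒1≤count f fx) (≤-reflexive c≡0)))

1≤count⇒true : ∀ {n} (f : Fin n → Bool) → 1 ≤ count f → ∃[ x ] f x ≡ true
1≤count⇒true {suc n} f 1≤c with f fzero in f0
... | true  = fzero , f0
... | false = let x , fx = 1≤count⇒true (f ∘ fsuc) 1≤c in fsuc x , fx

count-⊆-≡ : ∀ {n} {f g : Fin n → Bool} → f ⊆ g → count f ≡ count g → g ⊆ f
count-⊆-≡ {f = f} {g} f⊆g c≡c x gx = ≢false⇒≡true λ fx →
  ≡false⇒≢true (count≡0⇒false _ rest≡0 x) (∧-intro gx (not-intro fx))
  where
  rest≡0 : count (λ x → g x ∧ not (f x)) ≡ 0
  rest≡0 = +-cancelˡ-≡ (count f) _ 0 (trans (sym (count-⊆ f⊆g)) (trans (sym c≡c) (sym (+-identityʳ _))))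

count-at : ∀ {n} (f : Fin n → Bool) p → count (λ x → f x ∧ (x == p)) ≡ χ (f p)
count-at {suc n} f fzero = trans (cong₂ _+_ (cong χ (∧-identityʳ (f fzero))) (count-none (λ x → ∧-zeroʳ (f (fsuc x)))))
                                 (+-identityʳ _)
count-at {suc n} f (fsuc p) rewrite ∧-zeroʳ (f fzero) = count-at (f ∘ fsuc) p

count-remove : ∀ {n} (f : Fin n → Bool) {p} → f p ≡ true → count f ≡ suc (count (f ∖ p))
count-remove f {p} fp = trans (count-split f (_== p)) (cong (_+ count (f ∖ p)) (trans (count-at f p) (cong χ fp)))

distinct⇒2≤count : ∀ {n} (f : Fin n → Bool) {x y} → x ≢ y → f x ≡ true → f y ≡ true → 2 ≤ count f
distinct⇒2≤count f x≢y fx fy =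
  ≤-trans (s≤s (true⇒1≤count (f ∖ _) (∖-intro f fy (x≢y ∘ sym)))) (≤-reflexive (sym (count-remove f fx)))

distinct⇒3≤count : ∀ {n} (f : Fin n → Bool) {x y z} → x ≢ y → x ≢ z → y ≢ z →
                    f x ≡ true → f y ≡ true → f z ≡ true → 3 ≤ count f
distinct⇒3≤count f x≢y x≢z y≢z fx fy fz =
  ≤-trans (s≤s (distinct⇒2≤count (f ∖ _) y≢z (∖-intro f fy (x≢y ∘ sym)) (∖-intro f fz (x≢z ∘ sym))))
          (≤-reflexive (sym (count-remove f fx)))

2≤count⇒distinct : ∀ {n} (f : Fin n → Bool) → 2 ≤ count f →
                   ∃[ x ] ∃[ y ] x ≢ y × f x ≡ true × f y ≡ true
2≤count⇒distinct f 2≤c =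
  let x , fx = 1≤count⇒true f (≤-trans (s≤s z≤n) 2≤c)
      y , ∖y = 1≤count⇒true (f ∖ x) (≤-pred (≤-trans 2≤c (≤-reflexive (count-remove f fx))))
      fy , y≢x = ∖-elim f ∖y
  in x , y , y≢x ∘ sym , fx , fy

3≤count⇒third : ∀ {n} (f : Fin n → Bool) {x} y → 3 ≤ count f → f x ≡ true →
                ∃[ z ] f z ≡ true × z ≢ x × z ≢ y
3≤count⇒third f {x} y 3≤c fx
  with 2≤count⇒distinct (f ∖ x) (≤-pred (≤-trans 3≤c (≤-reflexive (count-remove f fx))))
... | a , b , a≢b , ∖a , ∖b with a Fin.≟ y
...   | no a≢y    = a , proj₁ (∖-elim f ∖a) , proj₂ (∖-elim f ∖a) , a≢y
...   | yes refl = b , proj₁ (∖-elim f ∖b) , proj₂ (∖-elim f ∖b) , a≢b ∘ sym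

count≡1⇒unique : ∀ {n} (f : Fin n → Bool) → count f ≡ 1 → ∀ {x y} → f x ≡ true → f y ≡ true → x ≡ y
count≡1⇒unique f c≡1 {x} {y} fx fy with x Fin.≟ y
... | yes x≡y = x≡y
... | no x≢y  = contradiction (≤-trans (distinct⇒2≤count f x≢y fx fy) (≤-reflexive c≡1)) (<-irrefl refl)

unique⇒count≡1 : ∀ {n} (f : Fin n → Bool) {p} → f p ≡ true → (∀ x → f x ≡ true → x ≡ p) → count f ≡ 1
unique⇒count≡1 f {p} fp unique = trans (count-remove f fp) (cong suc (count-none only-p))
  where
  only-p : ∀ x → (f ∖ p) x ≡ false
  only-p x = ≢true⇒≡false λ ∖x → let fx , x≢p = ∖-elim f ∖x in x≢p (unique x fx)

injection⇒≤count : ∀ {k n} (f : Fin n → Bool) (e : Fin k → Fin n) →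
                   (∀ i j → e i ≡ e j → i ≡ j) → (∀ i → f (e i) ≡ true) → k ≤ count f
injection⇒≤count {zero} f e inj onf = z≤n
injection⇒≤count {suc k} f e inj onf = ≤-trans (s≤s rest) (≤-reflexive (sym (count-remove f (onf fzero))))
  where
  rest : k ≤ count (f ∖ e fzero)
  rest = injection⇒≤count (f ∖ e fzero) (e ∘ fsuc) (λ i j e≡ → Fin.suc-injective (inj _ _ e≡))
           (λ i → ∖-intro f (onf (fsuc i)) (λ e≡ → Fin.0≢1+n (sym (inj _ _ e≡))))

enumerate : ∀ {n} k (f : Fin n → Bool) → count f ≡ k →
            Σ (Fin k → Fin n) λ e → (∀ i j → e i ≡ e j → i ≡ j) × (∀ i → f (e i) ≡ true) ×
                                    (∀ x → f x ≡ true → ∃[ i ] e i ≡ x)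
enumerate {zero} zero f _ = (λ ()) , (λ ()) , (λ ()) , (λ ())
enumerate {suc n} k f ∣f∣≡k with f fzero in f0
... | false = let e , injective , on-f , onto = enumerate k (f ∘ fsuc) ∣f∣≡k in
  fsuc ∘ e , (λ i j → injective i j ∘ Fin.suc-injective) , on-f ,
  λ { fzero fx → contradiction (trans (sym fx) f0) λ () ; (fsuc x) fx → map id (cong fsuc) (onto x fx) }
enumerate {suc n} (suc k) f ∣f∣≡k | true = let e , injective , on-f , onto = enumerate k (f ∘ fsuc) (suc-injective ∣f∣≡k) in
  fzero Vector.∷ fsuc ∘ e ,
  (λ { fzero fzero _ → refl ; fzero (fsuc _) () ; (fsuc _) fzero ()
     ; (fsuc i) (fsuc j) e≡ → cong fsuc (injective i j (Fin.suc-injective e≡)) }) ,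
  (λ { fzero → f0 ; (fsuc i) → on-f i }) ,
  λ { fzero _ → fzero , refl ; (fsuc x) fx → map fsuc (cong fsuc) (onto x fx) }

∑-zero : ∀ {n} (f : Fin n → ℕ) → (∀ x → f x ≡ 0) → ∑[ x < n ] f x ≡ 0
∑-zero {n} f f≡0 = trans (sum-cong-≗ f≡0) (sum-replicate-zero n)

∑-mono-≤ : ∀ {n} {f g : Fin n → ℕ} → (∀ x → f x ≤ g x) → sum f ≤ sum g
∑-mono-≤ {zero} _ = z≤n
∑-mono-≤ {suc n} f≤g = +-mono-≤ (f≤g fzero) (∑-mono-≤ (f≤g ∘ fsuc))

∑-if : ∀ {n} c (f : Fin n → Bool) → ∑[ x < n ] (if f x then c else 0) ≡ c * count f
∑-if {zero} c f = sym (*-zeroʳ c)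
∑-if {suc n} c f with f fzero
... | true  = trans (cong (c +_) (∑-if c (f ∘ fsuc))) (sym (*-suc c _))
... | false = ∑-if c (f ∘ fsuc)

count≡∑χ : ∀ {n} (f : Fin n → Bool) → count f ≡ ∑[ x < n ] χ (f x)
count≡∑χ f = sym (trans (∑-if 1 f) (*-identityˡ _))

*χ : ∀ q b → q * χ b ≡ (if b then q else 0)
*χ q true = *-identityʳ q
*χ q false = *-zeroʳ q

at-most-two-of-four : ∀ a b c d →
  a ∧ b ∧ c ≢ true → a ∧ b ∧ d ≢ true → a ∧ c ∧ d ≢ true → b ∧ c ∧ d ≢ true →
  χ a + (χ b + (χ c + (χ d + 0))) ≤ 2
at-most-two-of-four true  true  true  _     abc _   _   _   = contradiction refl abc
at-most-two-of-four true  true  false true  _   abd _   _   = contradiction refl abd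
at-most-two-of-four true  false true  true  _   _   acd _   = contradiction refl acd
at-most-two-of-four false true  true  true  _   _   _   bcd = contradiction refl bcd
at-most-two-of-four true  true  false false _   _   _   _   = ≤-refl
at-most-two-of-four true  false true  false _   _   _   _   = ≤-refl
at-most-two-of-four true  false false true  _   _   _   _   = ≤-refl
at-most-two-of-four false true  true  false _   _   _   _   = ≤-refl
at-most-two-of-four false true  false true  _   _   _   _   = ≤-refl
at-most-two-of-four false false true  true  _   _   _   _   = ≤-refl
at-most-two-of-four true  false false false _   _   _   _   = s≤s z≤n
at-most-two-of-four false true  false false _   _   _   _   = s≤s z≤n
at-most-two-of-four false false true  false _   _   _   _   = s≤s z≤n
at-most-two-of-four false false false true  _   _   _   _   = s≤s z≤n
at-most-two-of-four false false false false _   _   _   _   = z≤n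

split-weighted⇒≡1 : ∀ a b q m t → m ≢ t → a + b ≡ suc q → t * a + m * b ≡ q * m + t → a ≡ 1
split-weighted⇒≡1 0 .(suc q) q m t m≢t refl eq =
  contradiction (+-cancelʳ-≡ (q * m) m t (trans (lhs m q t) (trans eq (+-comm (q * m) t)))) m≢t
  where
  lhs : ∀ m q t → m + q * m ≡ t * 0 + m * suc q
  lhs = solve-∀
split-weighted⇒≡1 1 b q m t m≢t a+b eq = refl
split-weighted⇒≡1 (suc (suc a)) b .(suc (a + b)) m t m≢t refl eq =
  contradiction (sym (*-cancelʳ-≡ t m (suc a) (+-cancelʳ-≡ (t + m * b) _ _ (trans (lhs t a m b) (trans eq (rhs a b m t)))))) m≢t
  where
  lhs : ∀ t a m b → t * suc a + (t + m * b) ≡ t * suc (suc a) + m * b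
  lhs = solve-∀
  rhs : ∀ a b m t → suc (a + b) * m + t ≡ m * suc a + (t + m * b)
  rhs = solve-∀

squeeze : ∀ q b t c .{{_ : NonZero q}} → c + q ≡ q * suc b + t → c ≤ b * suc q → c ≤ t * suc q → t ≡ b
squeeze q b t c eq c≤b c≤t = ≤-antisym t≤b b≤t
  where
  open ≤-Reasoning
  t≤b : t ≤ b
  t≤b = +-cancelˡ-≤ (q * suc b) t b (begin
    q * suc b + t ≡⟨ eq ⟨
    c + q         ≤⟨ +-monoˡ-≤ q c≤b ⟩
    b * suc q + q ≡⟨ identity q b ⟩
    q * suc b + b ∎)
    where
    identity : ∀ q b → b * suc q + q ≡ q * suc b + b
    identity = solve-∀
  b≤t : b ≤ t
  b≤t = *-cancelˡ-≤ q (+-cancelʳ-≤ (q + t) (q * b) (q * t) (begin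
    q * b + (q + t) ≡⟨ identity₁ q b t ⟩
    q * suc b + t   ≡⟨ eq ⟨
    c + q           ≤⟨ +-monoˡ-≤ q c≤t ⟩
    t * suc q + q   ≡⟨ identity₂ q t ⟩
    q * t + (q + t) ∎))
    where
    identity₁ : ∀ q b t → q * b + (q + t) ≡ q * suc b + t
    identity₁ = solve-∀
    identity₂ : ∀ q t → t * suc q + q ≡ q * t + (q + t)
    identity₂ = solve-∀

baer-order : ∀ q t r b c → t + suc r ≡ suc q → suc r + b ≡ suc q →
             t * suc r + q * b ≡ c → c + q ≡ q * q + t → r * r ≡ q
baer-order q t r b c t+r+1≡q+1 r+1+b≡q+1 through-X size = +-cancelˡ-≡ (t * t + 2 * t * r + t) (r * r) q (begin
  t * t + 2 * t * r + t + r * r ≡⟨ identity₁ t r ⟩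
  (t + r) * (t + r) + t         ≡⟨ cong (λ x → x * x + t) q≡t+r ⟨
  q * q + t                     ≡⟨ size ⟨
  c + q                         ≡⟨ cong₂ _+_ through-X (sym q≡t+r) ⟨
  t * suc r + q * b + (t + r)   ≡⟨ cong (λ x → t * suc r + x * b + (t + r)) q≡t+r ⟩
  t * suc r + (t + r) * b + (t + r) ≡⟨ cong (λ x → t * suc r + (t + r) * x + (t + r)) b≡t ⟩
  t * suc r + (t + r) * t + (t + r) ≡⟨ identity₂ t r ⟩
  t * t + 2 * t * r + t + (t + r)   ≡⟨ cong (t * t + 2 * t * r + t +_) q≡t+r ⟨
  t * t + 2 * t * r + t + q       ∎)
  where
  open ≡-Reasoning
  q≡t+r : q ≡ t + r
  q≡t+r = suc-injective (trans (sym t+r+1≡q+1) (+-suc t r))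
  b≡t : b ≡ t
  b≡t = +-cancelˡ-≡ (suc r) b t (trans r+1+b≡q+1 (trans (sym t+r+1≡q+1) (+-comm t (suc r))))
  identity₁ : ∀ t r → t * t + 2 * t * r + t + r * r ≡ (t + r) * (t + r) + t
  identity₁ = solve-∀
  identity₂ : ∀ t r → t * suc r + (t + r) * t + (t + r) ≡ t * t + 2 * t * r + t + (t + r)
  identity₂ = solve-∀

module IncidenceStructure {np nl : ℕ} (I : Incidence np nl) where

  ∣_∩_∣ : (Fin np → Bool) → Fin nl → ℕ
  ∣ h ∩ l ∣ = count (λ p → h p ∧ I p l)

  double-count : ∀ (g : Fin nl → Bool) (h : Fin np → Bool) →
                 ∑[ l < nl ] (if g l then ∣ h ∩ l ∣ else 0) ≡
                 ∑[ p < np ] (if h p then count (λ l → g l ∧ I p l) else 0)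
  double-count g h = begin
    ∑[ l < nl ] (if g l then ∣ h ∩ l ∣ else 0)          ≡⟨ sum-cong-≗ by-line ⟩
    ∑[ l < nl ] ∑[ p < np ] χ (g l ∧ (h p ∧ I p l))      ≡⟨ ∑-comm (λ l p → χ (g l ∧ (h p ∧ I p l))) ⟩
    ∑[ p < np ] ∑[ l < nl ] χ (g l ∧ (h p ∧ I p l))      ≡⟨ sum-cong-≗ by-point ⟩
    ∑[ p < np ] (if h p then count (λ l → g l ∧ I p l) else 0) ∎
    where
    open ≡-Reasoning
    by-line : ∀ l → (if g l then ∣ h ∩ l ∣ else 0) ≡ ∑[ p < np ] χ (g l ∧ (h p ∧ I p l))
    by-line l with g l
    ... | true  = count≡∑χ (λ p → h p ∧ I p l)
    ... | false = sym (∑-zero {np} (λ _ → 0) (λ _ → refl))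
    by-point : ∀ p → ∑[ l < nl ] χ (g l ∧ (h p ∧ I p l)) ≡ (if h p then count (λ l → g l ∧ I p l) else 0)
    by-point p with h p
    ... | true  = sym (count≡∑χ (λ l → g l ∧ I p l))
    ... | false = ∑-zero (λ l → χ (g l ∧ false)) (λ l → cong χ (∧-zeroʳ (g l)))

  ∣∩∣≡count⇒⊆ : ∀ (h : Fin np → Bool) {l} → ∣ h ∩ l ∣ ≡ count h → ∀ p → h p ≡ true → I p l ≡ true
  ∣∩∣≡count⇒⊆ h {l} eq p hp = ∧-elimʳ (count-⊆-≡ {f = λ p → h p ∧ I p l} (λ _ → ∧-elimˡ) eq p hp)

  ∣∩∣≡∣l∣⇒⊇ : ∀ (h : Fin np → Bool) {l} → ∣ h ∩ l ∣ ≡ count (λ p → I p l) →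
              ∀ p → I p l ≡ true → h p ≡ true
  ∣∩∣≡∣l∣⇒⊇ h {l} eq p pl = ∧-elimˡ (count-⊆-≡ {f = λ p → h p ∧ I p l} (λ _ → ∧-elimʳ) eq p pl)

  Collinear : Fin np → Fin np → Fin np → Set
  Collinear x y z = ∃[ l ] I x l ≡ true × I y l ≡ true × I z l ≡ true

  Quadrangle : (Fin np → Bool) → (Fin nl → Bool) → Set
  Quadrangle P L = Σ (Fin 4 → Fin np) λ f → (∀ i → P (f i) ≡ true) × (∀ i j → i ≢ j → f i ≢ f j) ×
    (∀ i j k → i ≢ j → i ≢ k → j ≢ k → ∀ l → L l ≡ true →
       ¬ (I (f i) l ≡ true × I (f j) l ≡ true × I (f k) l ≡ true))

  quadrangle-from : ∀ (P : Fin np → Bool) (L : Fin nl → Bool) {x₀ x₁ x₂ x₃} →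
    All (λ x → P x ≡ true) (x₀ ∷ x₁ ∷ x₂ ∷ x₃ ∷ []) → Unique (x₀ ∷ x₁ ∷ x₂ ∷ x₃ ∷ []) →
    ¬ Collinear x₀ x₁ x₂ → ¬ Collinear x₀ x₁ x₃ → ¬ Collinear x₀ x₂ x₃ → ¬ Collinear x₁ x₂ x₃ →
    Quadrangle P L
  quadrangle-from P L {x₀} {x₁} {x₂} {x₃} in-P unique ¬012 ¬013 ¬023 ¬123 =
    lookup (x₀ ∷ x₁ ∷ x₂ ∷ x₃ ∷ []) , lookup⁺ in-P ,
    (λ i j i≢j fi≡fj → i≢j (lookup-injective unique i j fi≡fj)) ,
    λ i j k i≢j i≢k j≢k l _ (il , jl , kl) →
      <⇒≱ (s≤s (at-most-two-of-four (I x₀ l) (I x₁ l) (I x₂ l) (I x₃ l)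
                  (¬-on l ¬012) (¬-on l ¬013) (¬-on l ¬023) (¬-on l ¬123)))
          (distinct⇒3≤count (λ i → I (lookup (x₀ ∷ x₁ ∷ x₂ ∷ x₃ ∷ []) i) l) i≢j i≢k j≢k il jl kl)
    where
    ¬-on : ∀ {x y z} l → ¬ Collinear x y z → I x l ∧ I y l ∧ I z l ≢ true
    ¬-on {x} {y} {z} l ¬xyz e =
      ¬xyz (l , ∧-elimˡ e , ∧-elimˡ {I y l} (∧-elimʳ {I x l} e) , ∧-elimʳ {I y l} (∧-elimʳ {I x l} e))

module ProjectivePlane {np nl : ℕ} (I : Incidence np nl) (q : ℕ) (plane : IsProjectivePlane I q) where
  open IsProjectivePlaneOn plane
  open IncidenceStructure I public

  line-through : ∀ {p p'} → p ≢ p' → ∃[ l ] I p l ≡ true × I p' l ≡ true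
  line-through p≢p' = let l , (_ , pl , p'l) , _ = joins _ _ refl refl p≢p' in l , pl , p'l

  line-unique : ∀ {p p' l l'} → p ≢ p' → I p l ≡ true → I p' l ≡ true → I p l' ≡ true → I p' l' ≡ true → l ≡ l'
  line-unique p≢p' pl p'l pl' p'l' =
    let _ , _ , unique = joins _ _ refl refl p≢p' in trans (unique _ refl pl p'l) (sym (unique _ refl pl' p'l'))

  meet : ∀ {l l'} → l ≢ l' → ∃[ p ] I p l ≡ true × I p l' ≡ true
  meet l≢l' = let p , (_ , pl , pl') , _ = meets _ _ refl refl l≢l' in p , pl , pl'

  meet-unique : ∀ {l l' p p'} → l ≢ l' → I p l ≡ true → I p l' ≡ true → I p' l ≡ true → I p' l' ≡ true → p ≡ p'
  meet-unique l≢l' pl pl' p'l p'l' =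
    let _ , _ , unique = meets _ _ refl refl l≢l' in trans (unique _ refl pl pl') (sym (unique _ refl p'l p'l'))

  lines-through-two : ∀ {P p} → p ≢ P → count (λ l → I P l ∧ I p l) ≡ 1
  lines-through-two p≢P = let l , Pl , pl = line-through (p≢P ∘ sym) in
    unique⇒count≡1 _ (∧-intro Pl pl) (λ l' e → line-unique (p≢P ∘ sym) (∧-elimˡ e) (∧-elimʳ e) Pl pl)

  points-on-two : ∀ {l l'} → l ≢ l' → ∣ (λ p → I p l) ∩ l' ∣ ≡ 1
  points-on-two l≢l' = let p , pl , pl' = meet l≢l' in
    unique⇒count≡1 _ (∧-intro pl pl') (λ p' e → meet-unique l≢l' (∧-elimˡ e) (∧-elimʳ e) pl pl')

  no-point-on-every-line : ∀ P → ¬ (∀ l → I P l ≡ true)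
  no-point-on-every-line P on-every = pick-vertex-off-P (P Fin.≟ f 0F)
    where
    f : Fin 4 → Fin np
    f = proj₁ quadrangle
    distinct : ∀ i j → i ≢ j → f i ≢ f j
    distinct = proj₁ (proj₂ (proj₂ quadrangle))
    noncollinear : ∀ i j k → i ≢ j → i ≢ k → j ≢ k → ∀ l → true ≡ true →
                   ¬ (I (f i) l ≡ true × I (f j) l ≡ true × I (f k) l ≡ true)
    noncollinear = proj₂ (proj₂ (proj₂ quadrangle))
    through-P-collinear : ∀ i j k → i ≢ j → i ≢ k → j ≢ k → P ≢ f i → ⊥
    through-P-collinear i j k i≢j i≢k j≢k P≢i =
      let lj , ilj , jlj = line-through (distinct i j i≢j)
          lk , ilk , klk = line-through (distinct i k i≢k)
          lj≡lk = line-unique P≢i (on-every lj) ilj (on-every lk) ilk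
      in noncollinear i j k i≢j i≢k j≢k lj refl (ilj , jlj , subst (λ l → I (f k) l ≡ true) (sym lj≡lk) klk)
    pick-vertex-off-P : Dec (P ≡ f 0F) → ⊥
    pick-vertex-off-P (no P≢a)  = through-P-collinear 0F 1F 2F (λ ()) (λ ()) (λ ()) P≢a
    pick-vertex-off-P (yes P≡a) = through-P-collinear 1F 2F 3F (λ ()) (λ ()) (λ ()) (distinct 0F 1F (λ ()) ∘ trans (sym P≡a))

  line-missing : ∀ P → ∃[ l ] I P l ≡ false
  line-missing P with Fin.any? (λ l → I P l ≟ᵇ false)
  ... | yes found = found
  ... | no none   = contradiction (λ l → ≢false⇒≡true (λ Pl → none (l , Pl))) (no-point-on-every-line P)

  ∑-through : Fin np → (Fin nl → ℕ) → ℕ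
  ∑-through P f = ∑[ l < nl ] (if I P l then f l else 0)

  ∑-through-cong : ∀ P {f g : Fin nl → ℕ} → (∀ l → I P l ≡ true → f l ≡ g l) → ∑-through P f ≡ ∑-through P g
  ∑-through-cong P {f} {g} f≡g = sum-cong-≗ pointwise
    where
    pointwise : ∀ l → (if I P l then f l else 0) ≡ (if I P l then g l else 0)
    pointwise l with I P l in Pl
    ... | true  = f≡g l Pl
    ... | false = refl

  lines-through-point : ∀ P → count (I P) ≡ suc q
  lines-through-point P = let ℓ , Pℓ = line-missing P in begin
    count (I P)                                                    ≡⟨ count≡∑χ (I P) ⟩
    ∑[ l < nl ] χ (I P l)                                          ≡⟨ sum-cong-≗ (meets-ℓ-once ℓ Pℓ) ⟩
    ∑-through P ∣ (λ p → I p ℓ) ∩_∣                                 ≡⟨ double-count (I P) (λ p → I p ℓ) ⟩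
    ∑[ p < np ] (if I p ℓ then count (λ l → I P l ∧ I p l) else 0) ≡⟨ sum-cong-≗ (joins-P-once ℓ Pℓ) ⟩
    ∑[ p < np ] χ (I p ℓ)                                          ≡⟨ count≡∑χ (λ p → I p ℓ) ⟨
    count (λ p → I p ℓ)                                            ≡⟨ order ℓ refl ⟩
    suc q                                                          ∎
    where
    open ≡-Reasoning
    meets-ℓ-once : ∀ ℓ → I P ℓ ≡ false → ∀ l → χ (I P l) ≡ (if I P l then ∣ (λ p → I p ℓ) ∩ l ∣ else 0)
    meets-ℓ-once ℓ Pℓ l with I P l in Pl
    ... | true  = sym (points-on-two λ ℓ≡l → ≡false⇒≢true Pℓ (subst (λ l → I P l ≡ true) (sym ℓ≡l) Pl))
    ... | false = refl
    joins-P-once : ∀ ℓ → I P ℓ ≡ false → ∀ p → (if I p ℓ then count (λ l → I P l ∧ I p l) else 0) ≡ χ (I p ℓ)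
    joins-P-once ℓ Pℓ p with I p ℓ in pℓ
    ... | true  = lines-through-two λ p≡P → ≡false⇒≢true Pℓ (subst (λ x → I x ℓ ≡ true) p≡P pℓ)
    ... | false = refl

  ∑-through-∣∩∣ : ∀ P (h : Fin np → Bool) → ∑-through P ∣ h ∩_∣ ≡ count h + (if h P then q else 0)
  ∑-through-∣∩∣ P h = begin
    ∑-through P ∣ h ∩_∣
      ≡⟨ double-count (I P) h ⟩
    ∑[ p < np ] (if h p then count (λ l → I P l ∧ I p l) else 0)
      ≡⟨ sum-cong-≗ lines-through-P-and ⟩
    ∑[ p < np ] (χ (h p) + (if h p ∧ (p == P) then q else 0))
      ≡⟨ ∑-distrib-+ (χ ∘ h) (λ p → if h p ∧ (p == P) then q else 0) ⟩
    ∑[ p < np ] χ (h p) + ∑[ p < np ] (if h p ∧ (p == P) then q else 0)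
      ≡⟨ cong₂ _+_ (sym (count≡∑χ h)) (∑-if q (λ p → h p ∧ (p == P))) ⟩
    count h + q * count (λ p → h p ∧ (p == P))
      ≡⟨ cong (λ c → count h + q * c) (count-at h P) ⟩
    count h + q * χ (h P)
      ≡⟨ cong (count h +_) (*χ q (h P)) ⟩
    count h + (if h P then q else 0)
      ∎
    where
    open ≡-Reasoning
    lines-through-P-and : ∀ p → (if h p then count (λ l → I P l ∧ I p l) else 0) ≡
                                χ (h p) + (if h p ∧ (p == P) then q else 0)
    lines-through-P-and p with h p | p Fin.≟ P
    ... | false | _        = refl
    ... | true  | no p≢P   = lines-through-two p≢P
    ... | true  | yes refl = trans (count-cong (λ l → ∧-idem (I p l))) (lines-through-point p)

  ∑-through-two-valued : ∀ P (f : Fin nl → ℕ) (g : Fin nl → Bool) x y →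
    (∀ l → I P l ≡ true → f l ≡ (if g l then x else y)) →
    ∑-through P f ≡ x * count (λ l → I P l ∧ g l) + y * count (λ l → I P l ∧ not (g l))
  ∑-through-two-valued P f g x y f≡ = begin
    ∑-through P f
      ≡⟨ sum-cong-≗ pointwise ⟩
    ∑[ l < nl ] (if-x l + if-y l)
      ≡⟨ ∑-distrib-+ if-x if-y ⟩
    ∑[ l < nl ] if-x l + ∑[ l < nl ] if-y l
      ≡⟨ cong₂ _+_ (∑-if x (λ l → I P l ∧ g l)) (∑-if y (λ l → I P l ∧ not (g l))) ⟩
    x * count (λ l → I P l ∧ g l) + y * count (λ l → I P l ∧ not (g l))
      ∎
    where
    open ≡-Reasoning
    if-x if-y : Fin nl → ℕ
    if-x l = if I P l ∧ g l then x else 0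
    if-y l = if I P l ∧ not (g l) then y else 0
    pointwise : ∀ l → (if I P l then f l else 0) ≡ if-x l + if-y l
    pointwise l with I P l in Pl
    ... | false = refl
    ... | true rewrite f≡ l Pl with g l
    ...   | true  = sym (+-identityʳ x)
    ...   | false = refl

  lines-through-split : ∀ P (g : Fin nl → Bool) →
                        count (λ l → I P l ∧ g l) + count (λ l → I P l ∧ not (g l)) ≡ suc q
  lines-through-split P g = trans (sym (count-split (I P) g)) (lines-through-point P)

  ∑-through-≤ : ∀ P (f : Fin nl → ℕ) c → (∀ l → I P l ≡ true → f l ≤ c) → ∑-through P f ≤ c * suc q
  ∑-through-≤ P f c f≤c =
    ≤-trans (∑-mono-≤ pointwise) (≤-reflexive (trans (∑-if c (I P)) (cong (c *_) (lines-through-point P))))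
    where
    pointwise : ∀ l → (if I P l then f l else 0) ≤ (if I P l then c else 0)
    pointwise l with I P l in Pl
    ... | true  = f≤c l Pl
    ... | false = z≤n

  ∣∩∣+∣∩ᶜ∣ : ∀ (h : Fin np → Bool) l → ∣ h ∩ l ∣ + ∣ (not ∘ h) ∩ l ∣ ≡ suc q
  ∣∩∣+∣∩ᶜ∣ h l = begin
    ∣ h ∩ l ∣ + ∣ (not ∘ h) ∩ l ∣
      ≡⟨ cong₂ _+_ (count-cong (λ p → ∧-comm (h p) (I p l))) (count-cong (λ p → ∧-comm (not (h p)) (I p l))) ⟩
    count (λ p → I p l ∧ h p) + count (λ p → I p l ∧ not (h p))
      ≡⟨ count-split (λ p → I p l) h ⟨
    count (λ p → I p l)
      ≡⟨ order l refl ⟩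
    suc q
      ∎
    where open ≡-Reasoning

  point-count : np ≡ suc (q * suc q)
  point-count = +-cancelʳ-≡ q np _ (begin
    np + q                                  ≡⟨ cong (_+ q) (count-const-true np) ⟨
    count {np} (const true) + q             ≡⟨ ∑-through-∣∩∣ P (const true) ⟨
    ∑-through P ∣ const true ∩_∣             ≡⟨ ∑-through-cong P (λ l _ → order l refl) ⟩
    ∑-through P (const (suc q))             ≡⟨ ∑-if (suc q) (I P) ⟩
    suc q * count (I P)                     ≡⟨ cong (suc q *_) (lines-through-point P) ⟩
    suc q * suc q                           ≡⟨ expand q ⟩
    suc (q * suc q) + q                     ∎)
    where
    open ≡-Reasoning
    P : Fin np
    P = proj₁ quadrangle 0F
    expand : ∀ q → suc q * suc q ≡ suc (q * suc q) + q
    expand = solve-∀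

  ∑-through-χ : ∀ P (g : Fin nl → Bool) → ∑-through P (χ ∘ g) ≡ count (λ l → I P l ∧ g l)
  ∑-through-χ P g = trans (sum-cong-≗ pointwise) (sym (count≡∑χ (λ l → I P l ∧ g l)))
    where
    pointwise : ∀ l → (if I P l then χ (g l) else 0) ≡ χ (I P l ∧ g l)
    pointwise l with I P l
    ... | true  = refl
    ... | false = refl

  ∣∩∣-at-meet : ∀ (h : Fin np → Bool) {l l' Z} → l ≢ l' → I Z l ≡ true → I Z l' ≡ true →
                ∣ (λ p → h p ∧ I p l') ∩ l ∣ ≡ χ (h Z)
  ∣∩∣-at-meet h {l} {l'} {Z} l≢l' Zl Zl' = by-value (h Z) refl
    where
    on-meet : ∀ p → (h p ∧ I p l') ∧ I p l ≡ true → h p ≡ true × p ≡ Z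
    on-meet p e = ∧-elimˡ (∧-elimˡ {h p ∧ I p l'} e) ,
                  meet-unique l≢l' (∧-elimʳ {h p ∧ I p l'} e) (∧-elimʳ {h p} (∧-elimˡ {h p ∧ I p l'} e)) Zl Zl'
    by-value : ∀ b → h Z ≡ b → ∣ (λ p → h p ∧ I p l') ∩ l ∣ ≡ χ b
    by-value true hZ = unique⇒count≡1 (λ p → (h p ∧ I p l') ∧ I p l) (∧-intro (∧-intro hZ Zl') Zl)
                                      (λ p e → proj₂ (on-meet p e))
    by-value false hZ = count-none λ p → ≢true⇒≡false λ e →
      let hp , p≡Z = on-meet p e in ≡false⇒≢true hZ (subst (λ x → h x ≡ true) p≡Z hp)

  order≥2 : 2 ≤ q
  order≥2 = four-points⇒ q (≤-trans (injection⇒≤count (const true) f injective (λ _ → refl))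
                                     (≤-reflexive (trans (count-const-true np) point-count)))
    where
    f : Fin 4 → Fin np
    f = proj₁ quadrangle
    distinct : ∀ i j → i ≢ j → f i ≢ f j
    distinct = proj₁ (proj₂ (proj₂ quadrangle))
    injective : ∀ i j → f i ≡ f j → i ≡ j
    injective i j fi≡fj with i Fin.≟ j
    ... | yes i≡j = i≡j
    ... | no i≢j  = contradiction fi≡fj (distinct i j i≢j)
    four-points⇒ : ∀ q → 4 ≤ suc (q * suc q) → 2 ≤ q
    four-points⇒ (suc (suc q)) _ = s≤s (s≤s z≤n)
    four-points⇒ 0 (s≤s ())
    four-points⇒ 1 (s≤s (s≤s (s≤s ())))

  instance
    order-nonZero : NonZero q
    order-nonZero = >-nonZero (≤-trans (s≤s z≤n) order≥2)

  module _ {X Y X' A C ℓ₀ LX LY}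
           (X≢Y : X ≢ Y) (Xℓ₀ : I X ℓ₀ ≡ true) (Yℓ₀ : I Y ℓ₀ ≡ true) (X'ℓ₀ : I X' ℓ₀ ≡ false)
           (XLX : I X LX ≡ true) (X'LX : I X' LX ≡ true) (ALX : I A LX ≡ true) (A≢X : A ≢ X) (A≢X' : A ≢ X')
           (YLY : I Y LY ≡ true) (X'LY : I X' LY ≡ true) (CLY : I C LY ≡ true) (C≢Y : C ≢ Y) (C≢X' : C ≢ X') where

    private
      on-off : ∀ {z l l'} → l ≡ l' → I z l ≡ true → I z l' ≡ false → ⊥
      on-off refl zl zl' = ≡false⇒≢true zl' zl

      LX≢ℓ₀ : LX ≢ ℓ₀
      LX≢ℓ₀ LX≡ℓ₀ = on-off LX≡ℓ₀ X'LX X'ℓ₀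

      LY≢ℓ₀ : LY ≢ ℓ₀
      LY≢ℓ₀ LY≡ℓ₀ = on-off LY≡ℓ₀ X'LY X'ℓ₀

      LX≢LY : LX ≢ LY
      LX≢LY LX≡LY = LX≢ℓ₀ (line-unique X≢Y XLX (subst (λ l → I Y l ≡ true) (sym LX≡LY) YLY) Xℓ₀ Yℓ₀)

      Aℓ₀ : I A ℓ₀ ≡ false
      Aℓ₀ = ≢true⇒≡false λ Aℓ₀ → LX≢ℓ₀ (line-unique A≢X ALX XLX Aℓ₀ Xℓ₀)

      Cℓ₀ : I C ℓ₀ ≡ false
      Cℓ₀ = ≢true⇒≡false λ Cℓ₀ → LY≢ℓ₀ (line-unique C≢Y CLY YLY Cℓ₀ Yℓ₀)

      ALY : I A LY ≡ false
      ALY = ≢true⇒≡false λ ALY → LX≢LY (line-unique A≢X' ALX X'LX ALY X'LY)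

      CLX : I C LX ≡ false
      CLX = ≢true⇒≡false λ CLX → LX≢LY (line-unique C≢X' CLX X'LX CLY X'LY)

      XYAC-unique : Unique (X ∷ Y ∷ A ∷ C ∷ [])
      XYAC-unique = (X≢Y ∷ A≢X ∘ sym ∷ (λ X≡C → on-off refl (subst (λ x → I x ℓ₀ ≡ true) X≡C Xℓ₀) Cℓ₀) ∷ [])
                  ∷ ((λ Y≡A → on-off refl (subst (λ x → I x ℓ₀ ≡ true) Y≡A Yℓ₀) Aℓ₀) ∷ C≢Y ∘ sym ∷ [])
                  ∷ ((λ A≡C → on-off refl (subst (λ x → I x LX ≡ true) A≡C ALX) CLX) ∷ [])
                  ∷ [] ∷ []

      ¬Collinear-XYA : ¬ Collinear X Y A
      ¬Collinear-XYA (l , Xl , Yl , Al) = on-off (line-unique X≢Y Xl Yl Xℓ₀ Yℓ₀) Al Aℓ₀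

      ¬Collinear-XYC : ¬ Collinear X Y C
      ¬Collinear-XYC (l , Xl , Yl , Cl) = on-off (line-unique X≢Y Xl Yl Xℓ₀ Yℓ₀) Cl Cℓ₀

      ¬Collinear-XAC : ¬ Collinear X A C
      ¬Collinear-XAC (l , Xl , Al , Cl) = on-off (line-unique (A≢X ∘ sym) Xl Al XLX ALX) Cl CLX

      ¬Collinear-YAC : ¬ Collinear Y A C
      ¬Collinear-YAC (l , Yl , Al , Cl) = on-off (line-unique (C≢Y ∘ sym) Yl Cl YLY CLY) Al ALY

    quadrangle-XYAC : ∀ (P : Fin np → Bool) (L : Fin nl → Bool) → All (λ x → P x ≡ true) (X ∷ Y ∷ A ∷ C ∷ []) →
                      Quadrangle P L
    quadrangle-XYAC P L in-P = quadrangle-from P L in-P XYAC-unique ¬Collinear-XYA ¬Collinear-XYC ¬Collinear-XAC ¬Collinear-YAC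

module GeneralizedKMArc {np nl : ℕ} (I : Incidence np nl) (q m t : ℕ) (S : Fin np → Bool)
                        (plane : IsProjectivePlane I q) (arc : IsGenKMArc I q m t S) where
  open ProjectivePlane I q plane
  open IsProjectivePlaneOn plane using (order)
  open IsGenKMArc arc

  Sᶜ : Fin np → Bool
  Sᶜ = not ∘ S

  t-line : Fin nl → Bool
  t-line l = does (∣ S ∩ l ∣ ≟ t)

  t-line⇒≡t : ∀ {l} → t-line l ≡ true → ∣ S ∩ l ∣ ≡ t
  t-line⇒≡t = does≡true⇒ (_ ≟ t)

  ≡t⇒t-line : ∀ {l} → ∣ S ∩ l ∣ ≡ t → t-line l ≡ true
  ≡t⇒t-line = dec-true (_ ≟ t)

  ∣S∣+∣Sᶜ∣ : count S + count Sᶜ ≡ suc (q * suc q)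
  ∣S∣+∣Sᶜ∣ = trans (count-complement S) point-count

  ∣S∩∣+∣Sᶜ∩∣ : ∀ l → ∣ S ∩ l ∣ + ∣ Sᶜ ∩ l ∣ ≡ suc q
  ∣S∩∣+∣Sᶜ∩∣ = ∣∩∣+∣∩ᶜ∣ S

  ∣S∩∣≤q+1 : ∀ l → ∣ S ∩ l ∣ ≤ suc q
  ∣S∩∣≤q+1 l = ≤-trans (m≤m+n _ _) (≤-reflexive (∣S∩∣+∣Sᶜ∩∣ l))

  on-S⇒1≤∣S∩∣ : ∀ {p l} → S p ≡ true → I p l ≡ true → 1 ≤ ∣ S ∩ l ∣
  on-S⇒1≤∣S∩∣ {l = l} Sp pl = true⇒1≤count (λ p → S p ∧ I p l) (∧-intro Sp pl)

  off-S⇒∣S∩∣≤q : ∀ {p l} → S p ≡ false → I p l ≡ true → ∣ S ∩ l ∣ ≤ q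
  off-S⇒∣S∩∣≤q {p} {l} Sp pl = ≤-pred (begin
    suc (∣ S ∩ l ∣)           ≡⟨ +-comm 1 _ ⟩
    ∣ S ∩ l ∣ + 1             ≤⟨ +-monoʳ-≤ (∣ S ∩ l ∣) (true⇒1≤count (λ p → Sᶜ p ∧ I p l) (∧-intro (not-intro Sp) pl)) ⟩
    ∣ S ∩ l ∣ + ∣ Sᶜ ∩ l ∣    ≡⟨ ∣S∩∣+∣Sᶜ∩∣ l ⟩
    suc q                     ∎)
    where open ≤-Reasoning

  two-off-S⇒∣S∩∣<q : ∀ {p p' l} → p ≢ p' → S p ≡ false → S p' ≡ false → I p l ≡ true → I p' l ≡ true → ∣ S ∩ l ∣ < q
  two-off-S⇒∣S∩∣<q {p} {p'} {l} p≢p' Sp Sp' pl p'l = ≤-pred (begin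
    suc (suc ∣ S ∩ l ∣)       ≡⟨ +-comm 2 _ ⟩
    ∣ S ∩ l ∣ + 2             ≤⟨ +-monoʳ-≤ (∣ S ∩ l ∣) (distinct⇒2≤count (λ p → Sᶜ p ∧ I p l) p≢p'
                                                         (∧-intro (not-intro Sp) pl) (∧-intro (not-intro Sp') p'l)) ⟩
    ∣ S ∩ l ∣ + ∣ Sᶜ ∩ l ∣    ≡⟨ ∣S∩∣+∣Sᶜ∩∣ l ⟩
    suc q                     ∎)
    where open ≤-Reasoning

  ∈S≢∉S : ∀ {p p'} → S p ≡ true → S p' ≡ false → p ≢ p'
  ∈S≢∉S Sp Sp' p≡p' = ≡false⇒≢true Sp' (subst (λ x → S x ≡ true) p≡p' Sp)

  zero-line⇒off-S : ∀ {ℓ p} → ∣ S ∩ ℓ ∣ ≡ 0 → S p ≡ true → I p ℓ ≡ false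
  zero-line⇒off-S {ℓ} {p} c≡0 Sp = ≢true⇒≡false λ pℓ → ≡false⇒≢true (count≡0⇒false (λ p → S p ∧ I p ℓ) c≡0 p) (∧-intro Sp pℓ)

  t-line⇒t+∣Sᶜ∩∣ : ∀ {l} → t-line l ≡ true → t + ∣ Sᶜ ∩ l ∣ ≡ suc q
  t-line⇒t+∣Sᶜ∩∣ {l} tl = trans (cong (_+ ∣ Sᶜ ∩ l ∣) (sym (t-line⇒≡t tl))) (∣S∩∣+∣Sᶜ∩∣ l)

  ∣Sᶜ∣+t : m ≡ q → count Sᶜ + t ≡ q + suc q
  ∣Sᶜ∣+t refl = +-cancelˡ-≡ (count S + q) _ _ (begin
    count S + q + (count Sᶜ + t)    ≡⟨ regroup (count S) (count Sᶜ) q t ⟩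
    count S + count Sᶜ + (q + t)    ≡⟨ cong (_+ (q + t)) ∣S∣+∣Sᶜ∣ ⟩
    suc (q * suc q) + (q + t)       ≡⟨ expand q t ⟩
    q * q + t + (q + suc q)         ≡⟨ cong (_+ (q + suc q)) size ⟨
    count S + q + (q + suc q)       ∎)
    where
    open ≡-Reasoning
    regroup : ∀ a b q t → a + q + (b + t) ≡ a + b + (q + t)
    regroup = solve-∀
    expand : ∀ q t → suc (q * suc q) + (q + t) ≡ q * q + t + (q + suc q)
    expand = solve-∀

  ∑-through-off-S : ∀ {P} → S P ≡ false → ∑-through P ∣ S ∩_∣ ≡ count S
  ∑-through-off-S {P} SP = trans (∑-through-∣∩∣ P S) (trans (cong (λ b → count S + (if b then q else 0)) SP) (+-identityʳ _))

  ∑-through-on-S : ∀ {P} → S P ≡ true → ∑-through P ∣ S ∩_∣ ≡ q * m + t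
  ∑-through-on-S {P} SP = trans (∑-through-∣∩∣ P S) (trans (cong (λ b → count S + (if b then q else 0)) SP) size)

  module UniqueTLine (m≢t : m ≢ t) where

    t-lines-through-S : ∀ {R} → S R ≡ true → count (λ l → I R l ∧ t-line l) ≡ 1
    t-lines-through-S {R} SR = split-weighted⇒≡1 _ _ q m t m≢t (lines-through-split R t-line) (begin
      t * count (λ l → I R l ∧ t-line l) + m * count (λ l → I R l ∧ not (t-line l))
        ≡⟨ ∑-through-two-valued R ∣ S ∩_∣ t-line t m t-or-m ⟨
      ∑-through R ∣ S ∩_∣
        ≡⟨ ∑-through-on-S SR ⟩
      q * m + t
        ∎)
      where
      open ≡-Reasoning
      t-or-m : ∀ l → I R l ≡ true → ∣ S ∩ l ∣ ≡ (if t-line l then t else m)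
      t-or-m l Rl with t-line l in tl | lineType l
      ... | true  | _               = t-line⇒≡t tl
      ... | false | inj₁ c≡0        = contradiction (≤-trans (on-S⇒1≤∣S∩∣ SR Rl) (≤-reflexive c≡0)) λ ()
      ... | false | inj₂ (inj₁ c≡m) = c≡m
      ... | false | inj₂ (inj₂ c≡t) = contradiction (≡t⇒t-line c≡t) (≡false⇒≢true tl)

    t-line-through : ∀ {R} → S R ≡ true → ∃[ l ] I R l ≡ true × t-line l ≡ true
    t-line-through SR = let l , e = 1≤count⇒true _ (≤-reflexive (sym (t-lines-through-S SR))) in l , ∧-elimˡ e , ∧-elimʳ e

    t-line-unique : ∀ {R l l'} → S R ≡ true → I R l ≡ true → t-line l ≡ true → I R l' ≡ true → t-line l' ≡ true → l ≡ l'
    t-line-unique SR Rl tl Rl' tl' = count≡1⇒unique _ (t-lines-through-S SR) (∧-intro Rl tl) (∧-intro Rl' tl')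

    t-line-count : t * count t-line ≡ count S
    t-line-count = begin
      t * count t-line                                                     ≡⟨ ∑-if t t-line ⟨
      ∑[ l < nl ] (if t-line l then t else 0)                              ≡⟨ sum-cong-≗ on-t-lines ⟩
      ∑[ l < nl ] (if t-line l then ∣ S ∩ l ∣ else 0)                      ≡⟨ double-count t-line S ⟩
      ∑[ p < np ] (if S p then count (λ l → t-line l ∧ I p l) else 0)      ≡⟨ sum-cong-≗ one-each ⟩
      ∑[ p < np ] χ (S p)                                                  ≡⟨ count≡∑χ S ⟨
      count S                                                              ∎
      where
      open ≡-Reasoning
      on-t-lines : ∀ l → (if t-line l then t else 0) ≡ (if t-line l then ∣ S ∩ l ∣ else 0)
      on-t-lines l with t-line l in tl
      ... | true  = sym (t-line⇒≡t tl)
      ... | false = refl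
      one-each : ∀ p → (if S p then count (λ l → t-line l ∧ I p l) else 0) ≡ χ (S p)
      one-each p with S p in Sp
      ... | true  = trans (count-cong (λ l → ∧-comm (t-line l) (I p l))) (t-lines-through-S Sp)
      ... | false = refl

  m≡1⇒subset-of-line : m ≡ 1 → IsSubsetOfLine I S
  m≡1⇒subset-of-line m≡1 = second-point (true-somewhere? (S ∖ R))
    where
    R : Fin np
    R = proj₁ nonempty
    SR : S R ≡ true
    SR = proj₂ nonempty
    ∣S∣≡t : count S ≡ t
    ∣S∣≡t = +-cancelʳ-≡ q (count S) t
              (trans size (trans (cong (λ m → q * m + t) m≡1) (trans (cong (_+ t) (*-identityʳ q)) (+-comm q t))))
    secant⇒≡t : ∀ l → 2 ≤ ∣ S ∩ l ∣ → ∣ S ∩ l ∣ ≡ t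
    secant⇒≡t l 2≤c with lineType l
    ... | inj₁ c≡0        = contradiction (≤-trans 2≤c (≤-reflexive c≡0)) λ ()
    ... | inj₂ (inj₁ c≡m) = contradiction (≤-trans 2≤c (≤-reflexive (trans c≡m m≡1))) λ { (s≤s ()) }
    ... | inj₂ (inj₂ c≡t) = c≡t
    second-point : (∃[ R' ] (S ∖ R) R' ≡ true) ⊎ (∀ p → (S ∖ R) p ≡ false) → IsSubsetOfLine I S
    second-point (inj₁ (R' , S∖R[R'])) =
      let SR' , R'≢R = ∖-elim S S∖R[R']
          ℓ , Rℓ , R'ℓ = line-through (R'≢R ∘ sym)
          2≤∣S∩ℓ∣ = distinct⇒2≤count (λ p → S p ∧ I p ℓ) (R'≢R ∘ sym) (∧-intro SR Rℓ) (∧-intro SR' R'ℓ)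
      in ℓ , ∣∩∣≡count⇒⊆ S (trans (secant⇒≡t ℓ 2≤∣S∩ℓ∣) (sym ∣S∣≡t))
    second-point (inj₂ S∖R≡∅) =
      let ℓ , Rℓ , _ = line-through (∈S≢∉S SR (proj₂ proper))
          S⊆R = λ p Sp → decidable-stable (p Fin.≟ R) λ p≢R → ≡false⇒≢true (S∖R≡∅ p) (∖-intro S Sp p≢R)
      in ℓ , λ p Sp → subst (λ x → I x ℓ ≡ true) (sym (S⊆R p Sp)) Rℓ

  t≡q+1⇒m≢t : t ≡ suc q → m ≢ t
  t≡q+1⇒m≢t t≡q+1 m≡t = impossible (line-through (∈S≢∉S (proj₂ nonempty) (proj₂ proper)))
    where
    impossible : (∃[ l ] I (proj₁ nonempty) l ≡ true × I (proj₁ proper) l ≡ true) → ⊥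
    impossible (l , Rl , Ql) with lineType l
    ... | inj₁ c≡0        = contradiction (≤-trans (on-S⇒1≤∣S∩∣ (proj₂ nonempty) Rl) (≤-reflexive c≡0)) λ ()
    ... | inj₂ (inj₁ c≡m) = contradiction (trans c≡m (trans m≡t t≡q+1)) (<⇒≢ (s≤s (off-S⇒∣S∩∣≤q (proj₂ proper) Ql)))
    ... | inj₂ (inj₂ c≡t) = contradiction (trans c≡t t≡q+1) (<⇒≢ (s≤s (off-S⇒∣S∩∣≤q (proj₂ proper) Ql)))

  t≡q+1⇒line : t ≡ suc q → IsLine I S
  t≡q+1⇒line t≡q+1 = let ℓ , _ , tℓ = t-line-through (proj₂ nonempty) in ℓ , λ p → mk⇔ (S⊆ℓ tℓ p) (ℓ⊆S tℓ p)
    where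
    open UniqueTLine (t≡q+1⇒m≢t t≡q+1)
    ℓ⊆S : ∀ {ℓ} → t-line ℓ ≡ true → ∀ p → I p ℓ ≡ true → S p ≡ true
    ℓ⊆S {ℓ} tℓ = ∣∩∣≡∣l∣⇒⊇ S (trans (t-line⇒≡t tℓ) (trans t≡q+1 (sym (order ℓ refl))))
    S⊆ℓ : ∀ {ℓ} → t-line ℓ ≡ true → ∀ p → S p ≡ true → I p ℓ ≡ true
    S⊆ℓ {ℓ} tℓ p Sp = let l , pl , tl = t-line-through Sp in same-t-line pl tl (l Fin.≟ ℓ)
      where
      same-t-line : ∀ {l} → I p l ≡ true → t-line l ≡ true → Dec (l ≡ ℓ) → I p ℓ ≡ true
      same-t-line pl tl (yes refl) = pl
      same-t-line pl tl (no l≢ℓ)   = let X , Xl , Xℓ = meet l≢ℓ in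
        contradiction (t-line-unique (ℓ⊆S tℓ X Xℓ) Xl tl Xℓ tℓ) l≢ℓ

  m≡q+1⇒point-complement : m ≡ suc q → IsPointComplement I S
  m≡q+1⇒point-complement m≡q+1 = P , λ p → mk⇔ (λ Sp → ∈S≢∉S Sp SP) (λ p≢P → ≢false⇒≡true λ Sp →
    p≢P (count≡1⇒unique Sᶜ ∣Sᶜ∣≡1 (not-intro Sp) (not-intro SP)))
    where
    P : Fin np
    P = proj₁ proper
    SP : S P ≡ false
    SP = proj₂ proper
    ∣S∩∣≤t : ∀ l → I P l ≡ true → ∣ S ∩ l ∣ ≤ t
    ∣S∩∣≤t l Pl with lineType l
    ... | inj₁ c≡0        = ≤-trans (≤-reflexive c≡0) z≤n
    ... | inj₂ (inj₁ c≡m) = contradiction (≤-trans (≤-reflexive (sym (trans c≡m m≡q+1))) (off-S⇒∣S∩∣≤q SP Pl)) 1+n≰n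
    ... | inj₂ (inj₂ c≡t) = ≤-reflexive c≡t
    ∣S∣≤ : ∀ c → (∀ l → I P l ≡ true → ∣ S ∩ l ∣ ≤ c) → count S ≤ c * suc q
    ∣S∣≤ c bound = ≤-trans (≤-reflexive (sym (∑-through-off-S SP))) (∑-through-≤ P ∣ S ∩_∣ c bound)
    ∣S∣+q : count S + q ≡ q * suc q + t
    ∣S∣+q = trans size (cong (λ m → q * m + t) m≡q+1)
    t≡q : t ≡ q
    t≡q = squeeze q q t (count S) ∣S∣+q
                  (∣S∣≤ q (λ l → off-S⇒∣S∩∣≤q SP)) (∣S∣≤ t ∣S∩∣≤t)
    ∣Sᶜ∣≡1 : count Sᶜ ≡ 1
    ∣Sᶜ∣≡1 = +-cancelˡ-≡ (q * suc q) _ _ (begin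
      q * suc q + count Sᶜ  ≡⟨ cong (_+ count Sᶜ) (+-cancelʳ-≡ q _ _ (trans ∣S∣+q (cong (q * suc q +_) t≡q))) ⟨
      count S + count Sᶜ    ≡⟨ ∣S∣+∣Sᶜ∣ ⟩
      suc (q * suc q)       ≡⟨ +-comm 1 _ ⟩
      q * suc q + 1         ∎)
      where open ≡-Reasoning

  concurrent-lines-minus-point : ∀ P (g : Fin nl → Bool) → count g ≡ m → (∀ l → g l ≡ true → I P l ≡ true) →
    (∀ p → S p ≡ true ⇔ (p ≢ P × ∃[ l ] g l ≡ true × I p l ≡ true)) → IsConcurrentLinesMinusPoint I m S
  concurrent-lines-minus-point P g ∣g∣≡m g⇒P S⇔ with enumerate m g ∣g∣≡m
  ... | ls , injective , on-g , onto = P , ls , injective , (λ i → g⇒P (ls i) (on-g i)) , λ p → mk⇔ (to p) (from p)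
    where
    to : ∀ p → S p ≡ true → p ≢ P × ∃[ i ] I p (ls i) ≡ true
    to p Sp = let p≢P , l , gl , pl = Equivalence.to (S⇔ p) Sp; i , lsi≡l = onto l gl in
      p≢P , i , subst (λ l → I p l ≡ true) (sym lsi≡l) pl
    from : ∀ p → p ≢ P × ∃[ i ] I p (ls i) ≡ true → S p ≡ true
    from p (p≢P , i , pl) = Equivalence.from (S⇔ p) (p≢P , ls i , on-g i , pl)

  zero-line⇒line-complement : ∀ {ℓ} → ∣ S ∩ ℓ ∣ ≡ 0 → (∀ p → S p ≡ false → I p ℓ ≡ true) →
                              ∀ p → S p ≡ true ⇔ I p ℓ ≡ false
  zero-line⇒line-complement ∣S∩ℓ∣≡0 Sᶜ⊆ℓ p =
    mk⇔ (zero-line⇒off-S ∣S∩ℓ∣≡0) λ pℓ → ≢false⇒≡true λ Sp → ≡false⇒≢true pℓ (Sᶜ⊆ℓ p Sp)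

  m≡t≡q⇒line-complement : m ≡ q → t ≡ q → ∃[ ℓ ] (∀ p → S p ≡ true ⇔ I p ℓ ≡ false)
  m≡t≡q⇒line-complement m≡q t≡q = secant (2≤count⇒distinct Sᶜ (≤-trans (m≤n⇒m≤1+n order≥2) (≤-reflexive (sym ∣Sᶜ∣≡q+1))))
    where
    ∣Sᶜ∣≡q+1 : count Sᶜ ≡ suc q
    ∣Sᶜ∣≡q+1 = +-cancelʳ-≡ t _ _ (trans (∣Sᶜ∣+t m≡q) (trans (+-comm q (suc q)) (cong (suc q +_) (sym t≡q))))
    secant : (∃[ X ] ∃[ Y ] X ≢ Y × Sᶜ X ≡ true × Sᶜ Y ≡ true) → ∃[ ℓ ] (∀ p → S p ≡ true ⇔ I p ℓ ≡ false)
    secant (X , Y , X≢Y , SᶜX , SᶜY) with line-through X≢Y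
    ... | ℓ , Xℓ , Yℓ = ℓ , zero-line⇒line-complement ∣S∩ℓ∣≡0 Sᶜ⊆ℓ
      where
      ∣S∩ℓ∣<q : ∣ S ∩ ℓ ∣ < q
      ∣S∩ℓ∣<q = two-off-S⇒∣S∩∣<q X≢Y (not-elim SᶜX) (not-elim SᶜY) Xℓ Yℓ
      ∣S∩ℓ∣≡0 : ∣ S ∩ ℓ ∣ ≡ 0
      ∣S∩ℓ∣≡0 with lineType ℓ
      ... | inj₁ c≡0        = c≡0
      ... | inj₂ (inj₁ c≡m) = contradiction (trans c≡m m≡q) (<⇒≢ ∣S∩ℓ∣<q)
      ... | inj₂ (inj₂ c≡t) = contradiction (trans c≡t t≡q) (<⇒≢ ∣S∩ℓ∣<q)
      ∣Sᶜ∩ℓ∣≡∣Sᶜ∣ : ∣ Sᶜ ∩ ℓ ∣ ≡ count Sᶜ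
      ∣Sᶜ∩ℓ∣≡∣Sᶜ∣ = trans (trans (cong (_+ ∣ Sᶜ ∩ ℓ ∣) (sym ∣S∩ℓ∣≡0)) (∣S∩∣+∣Sᶜ∩∣ ℓ)) (sym ∣Sᶜ∣≡q+1)
      Sᶜ⊆ℓ : ∀ p → S p ≡ false → I p ℓ ≡ true
      Sᶜ⊆ℓ p Sp = ∣∩∣≡count⇒⊆ Sᶜ ∣Sᶜ∩ℓ∣≡∣Sᶜ∣ p (not-intro Sp)

  line-complement⇒concurrent-lines : m ≡ q → ∀ {ℓ} → (∀ p → S p ≡ true ⇔ I p ℓ ≡ false) →
                                     ∀ {P} → I P ℓ ≡ true → IsConcurrentLinesMinusPoint I m S
  line-complement⇒concurrent-lines m≡q {ℓ} S⇔off-ℓ {P} Pℓ =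
    concurrent-lines-minus-point P (I P ∖ ℓ) ∣I[P]∖ℓ∣≡m (λ l → ∧-elimˡ) S⇔
    where
    ∣I[P]∖ℓ∣≡m : count (I P ∖ ℓ) ≡ m
    ∣I[P]∖ℓ∣≡m = suc-injective (trans (sym (count-remove (I P) Pℓ)) (trans (lines-through-point P) (cong suc (sym m≡q))))
    S⇔ : ∀ p → S p ≡ true ⇔ (p ≢ P × ∃[ l ] (I P ∖ ℓ) l ≡ true × I p l ≡ true)
    S⇔ p = mk⇔ to from
      where
      to : S p ≡ true → p ≢ P × ∃[ l ] (I P ∖ ℓ) l ≡ true × I p l ≡ true
      to Sp = let pℓ = Equivalence.to (S⇔off-ℓ p) Sp
                  p≢P = λ p≡P → ≡false⇒≢true pℓ (subst (λ x → I x ℓ ≡ true) (sym p≡P) Pℓ)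
                  l , pl , Pl = line-through p≢P
              in p≢P , l , ∖-intro (I P) Pl (λ l≡ℓ → ≡false⇒≢true pℓ (subst (λ l → I p l ≡ true) l≡ℓ pl)) , pl
      from : p ≢ P × ∃[ l ] (I P ∖ ℓ) l ≡ true × I p l ≡ true → S p ≡ true
      from (p≢P , l , I[P]∖ℓ[l] , pl) = Equivalence.from (S⇔off-ℓ p) (≢true⇒≡false λ pℓ →
        proj₂ (∖-elim (I P) I[P]∖ℓ[l]) (line-unique p≢P pl (proj₁ (∖-elim (I P) I[P]∖ℓ[l])) pℓ Pℓ))

  m≡t≡q⇒concurrent-lines : m ≡ q → t ≡ q → IsConcurrentLinesMinusPoint I m S
  m≡t≡q⇒concurrent-lines m≡q t≡q =
    let ℓ , S⇔off-ℓ = m≡t≡q⇒line-complement m≡q t≡q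
        P , Pℓ = 1≤count⇒true (λ p → I p ℓ) (≤-trans (s≤s z≤n) (≤-reflexive (sym (order ℓ refl))))
    in line-complement⇒concurrent-lines m≡q S⇔off-ℓ Pℓ

  module _ (m≢t : m ≢ t) (t≡q : t ≡ q) where
    open UniqueTLine m≢t

    ∣Sᶜ∩t-line∣≡1 : ∀ {l} → t-line l ≡ true → ∣ Sᶜ ∩ l ∣ ≡ 1
    ∣Sᶜ∩t-line∣≡1 {l} tl = +-cancelˡ-≡ q _ _ (trans (cong (_+ ∣ Sᶜ ∩ l ∣) (sym t≡q)) (trans (t-line⇒t+∣Sᶜ∩∣ tl) (+-comm 1 q)))

    ∣t-lines∣≡m : count t-line ≡ m
    ∣t-lines∣≡m = *-cancelˡ-≡ _ _ q (+-cancelʳ-≡ q _ _ (begin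
      q * count t-line + q   ≡⟨ cong (λ t → t * count t-line + t) t≡q ⟨
      t * count t-line + t   ≡⟨ cong (_+ t) t-line-count ⟩
      count S + t            ≡⟨ cong (count S +_) t≡q ⟩
      count S + q            ≡⟨ size ⟩
      q * m + t              ≡⟨ cong (q * m +_) t≡q ⟩
      q * m + q              ∎))
      where open ≡-Reasoning

    module _ {ℓ₁ P} (tℓ₁ : t-line ℓ₁ ≡ true) (SP : S P ≡ false) (Pℓ₁ : I P ℓ₁ ≡ true) where

      off-S-on-t-line⇒P : ∀ {X l} → S X ≡ false → I X l ≡ true → t-line l ≡ true → I P l ≡ true → X ≡ P
      off-S-on-t-line⇒P SX Xl tl Pl = count≡1⇒unique _ (∣Sᶜ∩t-line∣≡1 tl) (∧-intro (not-intro SX) Xl) (∧-intro (not-intro SP) Pl)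

      t-line⇒P : ∀ l → t-line l ≡ true → I P l ≡ true
      t-line⇒P l tl with l Fin.≟ ℓ₁
      ... | yes refl = Pℓ₁
      ... | no l≢ℓ₁ = let X , Xl , Xℓ₁ = meet l≢ℓ₁
                          SX = ≢true⇒≡false λ SX → l≢ℓ₁ (t-line-unique SX Xl tl Xℓ₁ tℓ₁)
                      in subst (λ x → I x l ≡ true) (off-S-on-t-line⇒P SX Xℓ₁ tℓ₁ Pℓ₁) Xl

      S⇔on-t-line : ∀ p → S p ≡ true ⇔ (p ≢ P × ∃[ l ] t-line l ≡ true × I p l ≡ true)
      S⇔on-t-line p = mk⇔ (λ Sp → ∈S≢∉S Sp SP , let l , pl , tl = t-line-through Sp in l , tl , pl)
                          (λ (p≢P , l , tl , pl) → ≢false⇒≡true λ Sp → p≢P (off-S-on-t-line⇒P Sp pl tl (t-line⇒P l tl)))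

    m≢t≡q⇒concurrent-lines : IsConcurrentLinesMinusPoint I m S
    m≢t≡q⇒concurrent-lines =
      let ℓ₁ , _ , tℓ₁ = t-line-through (proj₂ nonempty)
          P , SᶜP∧Pℓ₁ = 1≤count⇒true (λ p → Sᶜ p ∧ I p ℓ₁) (≤-reflexive (sym (∣Sᶜ∩t-line∣≡1 tℓ₁)))
          SP = not-elim (∧-elimˡ SᶜP∧Pℓ₁)
          Pℓ₁ = ∧-elimʳ SᶜP∧Pℓ₁
      in concurrent-lines-minus-point P t-line ∣t-lines∣≡m (t-line⇒P tℓ₁ SP Pℓ₁) (S⇔on-t-line tℓ₁ SP Pℓ₁)

  t≡q⇒concurrent-lines : t ≡ q → IsConcurrentLinesMinusPoint I m S
  t≡q⇒concurrent-lines t≡q with m ≟ q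
  ... | yes m≡q = m≡t≡q⇒concurrent-lines m≡q t≡q
  ... | no m≢q  = m≢t≡q⇒concurrent-lines (λ m≡t → m≢q (trans m≡t t≡q)) t≡q

  m≡q⇒zero-line⇒affine : m ≡ q → ∀ ℓ → ∣ S ∩ ℓ ∣ ≡ 0 → IsAffineMinusAtMostOnePoint I S
  m≡q⇒zero-line⇒affine m≡q ℓ ∣S∩ℓ∣≡0 = extra-point (true-somewhere? (λ p → Sᶜ p ∧ not (I p ℓ)))
    where
    ℓ⇒off-S : ∀ {p} → I p ℓ ≡ true → S p ≡ false
    ℓ⇒off-S pℓ = ≢true⇒≡false λ Sp → ≡false⇒≢true (zero-line⇒off-S ∣S∩ℓ∣≡0 Sp) pℓ
    extra-point : (∃[ Y ] Sᶜ Y ∧ not (I Y ℓ) ≡ true) ⊎ (∀ p → Sᶜ p ∧ not (I p ℓ) ≡ false) →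
                  IsAffineMinusAtMostOnePoint I S
    extra-point (inj₂ none) = ℓ , inj₁ λ p → mk⇔ (zero-line⇒off-S ∣S∩ℓ∣≡0) λ pℓ → ≢false⇒≡true λ Sp →
      ≡false⇒≢true (none p) (∧-intro (not-intro Sp) (not-intro pℓ))
    -- Every line through Y meets ℓ off S, so it carries fewer than q points of S; this forces t = q - 1.
    extra-point (inj₁ (Y , e)) = ℓ , inj₂ (Y , Yℓ , λ p → mk⇔ (to p) (from p))
      where
      SY : S Y ≡ false
      SY = not-elim (∧-elimˡ e)
      Yℓ : I Y ℓ ≡ false
      Yℓ = not-elim (∧-elimʳ e)
      ∣S∩∣<q : ∀ l → I Y l ≡ true → ∣ S ∩ l ∣ < q
      ∣S∩∣<q l Yl = let l≢ℓ = λ l≡ℓ → ≡false⇒≢true Yℓ (subst (λ l → I Y l ≡ true) l≡ℓ Yl)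
                        Z , Zl , Zℓ = meet l≢ℓ
                        Y≢Z = λ Y≡Z → ≡false⇒≢true Yℓ (subst (λ x → I x ℓ ≡ true) (sym Y≡Z) Zℓ)
                    in two-off-S⇒∣S∩∣<q Y≢Z SY (ℓ⇒off-S Zℓ) Yl Zl
      ∣S∩∣≤t : ∀ l → I Y l ≡ true → ∣ S ∩ l ∣ ≤ t
      ∣S∩∣≤t l Yl with lineType l
      ... | inj₁ c≡0        = ≤-trans (≤-reflexive c≡0) z≤n
      ... | inj₂ (inj₁ c≡m) = contradiction (trans c≡m m≡q) (<⇒≢ (∣S∩∣<q l Yl))
      ... | inj₂ (inj₂ c≡t) = ≤-reflexive c≡t
      ∣S∣≤ : ∀ c → (∀ l → I Y l ≡ true → ∣ S ∩ l ∣ ≤ c) → count S ≤ c * suc q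
      ∣S∣≤ c bound = ≤-trans (≤-reflexive (sym (∑-through-off-S SY))) (∑-through-≤ Y ∣ S ∩_∣ c bound)
      q≡1+t : q ≡ suc t
      q≡1+t = sym (trans (cong suc (squeeze q (pred q) t (count S)
                                      (trans size (cong (λ x → q * x + t) (trans m≡q (sym (suc-pred q)))))
                                      (∣S∣≤ (pred q) (λ l Yl → <⇒≤pred (∣S∩∣<q l Yl))) (∣S∣≤ t ∣S∩∣≤t)))
                         (suc-pred q))
      ∣Sᶜ∣≡q+2 : count Sᶜ ≡ suc (suc q)
      ∣Sᶜ∣≡q+2 = +-cancelʳ-≡ t _ _ (trans (∣Sᶜ∣+t m≡q) (trans (cong (_+ suc q) q≡1+t) (regroup t q)))
        where
        regroup : ∀ t q → suc t + suc q ≡ suc (suc q) + t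
        regroup = solve-∀
      to : ∀ p → S p ≡ true → I p ℓ ≡ false × p ≢ Y
      to p Sp = zero-line⇒off-S ∣S∩ℓ∣≡0 Sp , ∈S≢∉S Sp SY
      from : ∀ p → I p ℓ ≡ false × p ≢ Y → S p ≡ true
      from p (pℓ , p≢Y) = ≢false⇒≡true λ Sp → contradiction (begin
        suc q + 2
          ≤⟨ +-monoʳ-≤ (suc q) (distinct⇒2≤count Sᶜ-off-ℓ p≢Y (∧-intro (not-intro Sp) (not-intro pℓ)) e) ⟩
        suc q + count Sᶜ-off-ℓ
          ≡⟨ cong (_+ count Sᶜ-off-ℓ) (order ℓ refl) ⟨
        count (λ x → I x ℓ) + count Sᶜ-off-ℓ
          ≡⟨ count-⊆ {f = λ x → I x ℓ} {g = Sᶜ} (λ x xℓ → not-intro (ℓ⇒off-S xℓ)) ⟨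
        count Sᶜ
          ≡⟨ ∣Sᶜ∣≡q+2 ⟩
        suc (suc q)
          ∎) (<⇒≱ (≤-reflexive (+-comm 2 (suc q))))
        where
        open ≤-Reasoning
        Sᶜ-off-ℓ : Fin np → Bool
        Sᶜ-off-ℓ x = Sᶜ x ∧ not (I x ℓ)

  module Baer (m≡q : m ≡ q) (t≢q : t ≢ q) (no-zero-line : ∀ l → ∣ S ∩ l ∣ ≢ 0) where

    m≢t : m ≢ t
    m≢t m≡t = t≢q (trans (sym m≡t) m≡q)

    open UniqueTLine m≢t

    non-t-line⇒∣S∩∣≡q : ∀ l → t-line l ≡ false → ∣ S ∩ l ∣ ≡ q
    non-t-line⇒∣S∩∣≡q l tl with lineType l
    ... | inj₁ c≡0        = contradiction c≡0 (no-zero-line l)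
    ... | inj₂ (inj₁ c≡m) = trans c≡m m≡q
    ... | inj₂ (inj₂ c≡t) = contradiction (≡t⇒t-line c≡t) (≡false⇒≢true tl)

    non-t-line⇒∣Sᶜ∩∣≡1 : ∀ {l} → t-line l ≡ false → ∣ Sᶜ ∩ l ∣ ≡ 1
    non-t-line⇒∣Sᶜ∩∣≡1 {l} tl = +-cancelˡ-≡ q _ _
      (trans (cong (_+ ∣ Sᶜ ∩ l ∣) (sym (non-t-line⇒∣S∩∣≡q l tl))) (trans (∣S∩∣+∣Sᶜ∩∣ l) (+-comm 1 q)))

    secant⇒t-line : ∀ {X Y l} → X ≢ Y → S X ≡ false → S Y ≡ false → I X l ≡ true → I Y l ≡ true → t-line l ≡ true
    secant⇒t-line {l = l} X≢Y SX SY Xl Yl = ≢false⇒≡true λ tl →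
      <⇒≢ (two-off-S⇒∣S∩∣<q X≢Y SX SY Xl Yl) (non-t-line⇒∣S∩∣≡q l tl)

    -- A line through X' meets ℓ in one point, and it is a t-line exactly when that point is off S.
    t-lines-through-off-line : ∀ {ℓ X'} → t-line ℓ ≡ true → S X' ≡ false → I X' ℓ ≡ false →
                               count (λ l → I X' l ∧ t-line l) ≡ ∣ Sᶜ ∩ ℓ ∣
    t-lines-through-off-line {ℓ} {X'} tℓ SX' X'ℓ = begin
      count (λ l → I X' l ∧ t-line l)                 ≡⟨ ∑-through-χ X' t-line ⟨
      ∑-through X' (χ ∘ t-line)                       ≡⟨ ∑-through-cong X' meets-ℓ-in-Sᶜ ⟩
      ∑-through X' ∣ (λ p → Sᶜ p ∧ I p ℓ) ∩_∣         ≡⟨ ∑-through-∣∩∣ X' (λ p → Sᶜ p ∧ I p ℓ) ⟩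
      ∣ Sᶜ ∩ ℓ ∣ + (if Sᶜ X' ∧ I X' ℓ then q else 0)  ≡⟨ cong (λ b → ∣ Sᶜ ∩ ℓ ∣ + (if b then q else 0)) X'∉Sᶜ∩ℓ ⟩
      ∣ Sᶜ ∩ ℓ ∣ + 0                                   ≡⟨ +-identityʳ _ ⟩
      ∣ Sᶜ ∩ ℓ ∣                                       ∎
      where
      open ≡-Reasoning
      X'∉Sᶜ∩ℓ : Sᶜ X' ∧ I X' ℓ ≡ false
      X'∉Sᶜ∩ℓ = trans (cong (Sᶜ X' ∧_) X'ℓ) (∧-zeroʳ (Sᶜ X'))
      Sᶜ-at-meet : ∀ {l Z} → l ≢ ℓ → I X' l ≡ true → I Z l ≡ true → I Z ℓ ≡ true → Sᶜ Z ≡ t-line l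
      Sᶜ-at-meet {l} {Z} l≢ℓ X'l Zl Zℓ with t-line l in tl
      ... | true  = not-intro (≢true⇒≡false λ SZ → l≢ℓ (t-line-unique SZ Zl tl Zℓ tℓ))
      ... | false = ≢true⇒≡false λ SᶜZ → ≡false⇒≢true X'ℓ (subst (λ x → I x ℓ ≡ true)
                      (count≡1⇒unique _ (non-t-line⇒∣Sᶜ∩∣≡1 tl) (∧-intro SᶜZ Zl) (∧-intro (not-intro SX') X'l)) Zℓ)
      meets-ℓ-in-Sᶜ : ∀ l → I X' l ≡ true → χ (t-line l) ≡ ∣ (λ p → Sᶜ p ∧ I p ℓ) ∩ l ∣
      meets-ℓ-in-Sᶜ l X'l =
        let l≢ℓ = λ l≡ℓ → ≡false⇒≢true X'ℓ (subst (λ l → I X' l ≡ true) l≡ℓ X'l)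
            Z , Zl , Zℓ = meet l≢ℓ
        in trans (cong χ (sym (Sᶜ-at-meet l≢ℓ X'l Zl Zℓ))) (sym (∣∩∣-at-meet Sᶜ l≢ℓ Zl Zℓ))

    module Configuration {X Y X' ℓ₀} (X≢Y : X ≢ Y) (SX : S X ≡ false) (SY : S Y ≡ false) (SX' : S X' ≡ false)
                         (Xℓ₀ : I X ℓ₀ ≡ true) (Yℓ₀ : I Y ℓ₀ ≡ true) (X'ℓ₀ : I X' ℓ₀ ≡ false) where

      tℓ₀ : t-line ℓ₀ ≡ true
      tℓ₀ = secant⇒t-line X≢Y SX SY Xℓ₀ Yℓ₀

      2≤∣Sᶜ∩ℓ₀∣ : 2 ≤ ∣ Sᶜ ∩ ℓ₀ ∣
      2≤∣Sᶜ∩ℓ₀∣ = distinct⇒2≤count (λ p → Sᶜ p ∧ I p ℓ₀) X≢Y (∧-intro (not-intro SX) Xℓ₀) (∧-intro (not-intro SY) Yℓ₀)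

      r : ℕ
      r = pred ∣ Sᶜ ∩ ℓ₀ ∣

      ∣Sᶜ∩ℓ₀∣≡r+1 : ∣ Sᶜ ∩ ℓ₀ ∣ ≡ suc r
      ∣Sᶜ∩ℓ₀∣≡r+1 = sym (suc-pred _ {{>-nonZero (≤-trans (s≤s z≤n) 2≤∣Sᶜ∩ℓ₀∣)}})

      t+r+1≡q+1 : t + suc r ≡ suc q
      t+r+1≡q+1 = trans (cong (t +_) (sym ∣Sᶜ∩ℓ₀∣≡r+1)) (t-line⇒t+∣Sᶜ∩∣ tℓ₀)

      -- Count S along the lines through X': r + 1 are t-lines, the other q - r carry q points of S each.
      r*r≡q : r * r ≡ q
      r*r≡q = baer-order q t r _ (count S) t+r+1≡q+1
                (trans (cong (_+ count (λ l → I X' l ∧ not (t-line l))) (sym a≡r+1)) (lines-through-split X' t-line))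
                (trans (cong (λ a → t * a + q * count (λ l → I X' l ∧ not (t-line l))) (sym a≡r+1))
                       (trans (sym (∑-through-two-valued X' ∣ S ∩_∣ t-line t q t-or-q)) (∑-through-off-S SX')))
                (trans size (cong (λ m → q * m + t) m≡q))
        where
        a≡r+1 : count (λ l → I X' l ∧ t-line l) ≡ suc r
        a≡r+1 = trans (t-lines-through-off-line tℓ₀ SX' X'ℓ₀) ∣Sᶜ∩ℓ₀∣≡r+1
        t-or-q : ∀ l → I X' l ≡ true → ∣ S ∩ l ∣ ≡ (if t-line l then t else q)
        t-or-q l _ with t-line l in tl
        ... | true  = t-line⇒≡t tl
        ... | false = non-t-line⇒∣S∩∣≡q l tl

      ∣Sᶜ∩t-line∣≡r+1 : ∀ {l} → t-line l ≡ true → ∣ Sᶜ ∩ l ∣ ≡ suc r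
      ∣Sᶜ∩t-line∣≡r+1 tl = +-cancelˡ-≡ t _ _ (trans (t-line⇒t+∣Sᶜ∩∣ tl) (sym t+r+1≡q+1))

      3≤∣Sᶜ∩t-line∣ : ∀ {l} → t-line l ≡ true → 3 ≤ ∣ Sᶜ ∩ l ∣
      3≤∣Sᶜ∩t-line∣ tl =
        ≤-trans (s≤s (2≤r r (≤-trans order≥2 (≤-reflexive (sym r*r≡q))))) (≤-reflexive (sym (∣Sᶜ∩t-line∣≡r+1 tl)))
        where
        2≤r : ∀ r → 2 ≤ r * r → 2 ≤ r
        2≤r 0 ()
        2≤r 1 (s≤s ())
        2≤r (suc (suc r)) _ = s≤s (s≤s z≤n)

      X≢X' : X ≢ X'
      X≢X' X≡X' = ≡false⇒≢true X'ℓ₀ (subst (λ x → I x ℓ₀ ≡ true) X≡X' Xℓ₀)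

      Y≢X' : Y ≢ X'
      Y≢X' Y≡X' = ≡false⇒≢true X'ℓ₀ (subst (λ x → I x ℓ₀ ≡ true) Y≡X' Yℓ₀)

      baer-quadrangle : Quadrangle Sᶜ t-line
      baer-quadrangle =
        let LX , XLX , X'LX = line-through X≢X'
            LY , YLY , X'LY = line-through Y≢X'
            A , SᶜA∧ALX , A≢X , A≢X' = 3≤count⇒third (λ p → Sᶜ p ∧ I p LX) X'
                                          (3≤∣Sᶜ∩t-line∣ (secant⇒t-line X≢X' SX SX' XLX X'LX)) (∧-intro (not-intro SX) XLX)
            C , SᶜC∧CLY , C≢Y , C≢X' = 3≤count⇒third (λ p → Sᶜ p ∧ I p LY) X'
                                          (3≤∣Sᶜ∩t-line∣ (secant⇒t-line Y≢X' SY SX' YLY X'LY)) (∧-intro (not-intro SY) YLY)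
            ALX = ∧-elimʳ SᶜA∧ALX
            CLY = ∧-elimʳ SᶜC∧CLY
        in quadrangle-XYAC X≢Y Xℓ₀ Yℓ₀ X'ℓ₀ XLX X'LX ALX A≢X A≢X' YLY X'LY CLY C≢Y C≢X' Sᶜ t-line
             (not-intro SX ∷ not-intro SY ∷ ∧-elimˡ SᶜA∧ALX ∷ ∧-elimˡ SᶜC∧CLY ∷ [])

      baer-subplane : IsBaerSubplanePoints I q Sᶜ
      baer-subplane = t-line , r , r*r≡q , record
        { joins = λ p p' Sᶜp Sᶜp' p≢p' → let l , pl , p'l = line-through p≢p' in
            l , (secant⇒t-line p≢p' (not-elim Sᶜp) (not-elim Sᶜp') pl p'l , pl , p'l) ,
            λ l' _ pl' p'l' → line-unique p≢p' pl' p'l' pl p'l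
        ; meets = λ l l' tl tl' l≢l' → let Z , Zl , Zl' = meet l≢l' in
            Z , (not-intro (≢true⇒≡false λ SZ → l≢l' (t-line-unique SZ Zl tl Zl' tl')) , Zl , Zl') ,
            λ p _ pl pl' → meet-unique l≢l' pl pl' Zl Zl'
        ; quadrangle = baer-quadrangle
        ; order = λ l tl → ∣Sᶜ∩t-line∣≡r+1 tl
        }

    ∣Sᶜ-off-t-line∣≡q : ∀ {ℓ} → t-line ℓ ≡ true → count (λ p → Sᶜ p ∧ not (I p ℓ)) ≡ q
    ∣Sᶜ-off-t-line∣≡q {ℓ} tℓ = +-cancelʳ-≡ (suc q) _ _ (begin
      off + suc q                ≡⟨ cong (off +_) (t-line⇒t+∣Sᶜ∩∣ tℓ) ⟨
      off + (t + ∣ Sᶜ ∩ ℓ ∣)      ≡⟨ regroup off t ∣ Sᶜ ∩ ℓ ∣ ⟩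
      (∣ Sᶜ ∩ ℓ ∣ + off) + t      ≡⟨ cong (_+ t) (count-split Sᶜ (λ p → I p ℓ)) ⟨
      count Sᶜ + t               ≡⟨ ∣Sᶜ∣+t m≡q ⟩
      q + suc q                  ∎)
      where
      open ≡-Reasoning
      off : ℕ
      off = count (λ p → Sᶜ p ∧ not (I p ℓ))
      regroup : ∀ a b c → a + (b + c) ≡ (c + a) + b
      regroup = solve-∀

    baer-complement : IsBaerComplement I q S
    baer-complement = Sᶜ , choose-secant (2≤count⇒distinct Sᶜ (≤-trans order≥2 q≤∣Sᶜ∣)) ,
                      λ p → mk⇔ (cong not) λ Sᶜp → ≢false⇒≡true λ Sp → ≡false⇒≢true Sᶜp (not-intro Sp)
      where
      t≤q+1 : t ≤ suc q
      t≤q+1 = let ℓ , _ , tℓ = t-line-through (proj₂ nonempty) in ≤-trans (≤-reflexive (sym (t-line⇒≡t tℓ))) (∣S∩∣≤q+1 ℓ)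
      q≤∣Sᶜ∣ : q ≤ count Sᶜ
      q≤∣Sᶜ∣ = +-cancelʳ-≤ (suc q) q (count Sᶜ) (≤-trans (≤-reflexive (sym (∣Sᶜ∣+t m≡q))) (+-monoʳ-≤ (count Sᶜ) t≤q+1))
      choose-secant : (∃[ X ] ∃[ Y ] X ≢ Y × Sᶜ X ≡ true × Sᶜ Y ≡ true) → IsBaerSubplanePoints I q Sᶜ
      choose-secant (X , Y , X≢Y , SᶜX , SᶜY) =
        let ℓ₀ , Xℓ₀ , Yℓ₀ = line-through X≢Y
            tℓ₀ = secant⇒t-line X≢Y (not-elim SᶜX) (not-elim SᶜY) Xℓ₀ Yℓ₀
            X' , SᶜX'∧X'∉ℓ₀ = 1≤count⇒true (λ p → Sᶜ p ∧ not (I p ℓ₀))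
                                (≤-trans (≤-trans (s≤s z≤n) order≥2) (≤-reflexive (sym (∣Sᶜ-off-t-line∣≡q tℓ₀))))
        in Configuration.baer-subplane X≢Y (not-elim SᶜX) (not-elim SᶜY) (not-elim (∧-elimˡ SᶜX'∧X'∉ℓ₀))
                                       Xℓ₀ Yℓ₀ (not-elim (∧-elimʳ SᶜX'∧X'∉ℓ₀))

  m≡q⇒baer-or-affine : m ≡ q → IsBaerComplement I q S ⊎ IsAffineMinusAtMostOnePoint I S
  m≡q⇒baer-or-affine m≡q with t ≟ q
  ... | yes t≡q = inj₂ (let ℓ , S⇔off-ℓ = m≡t≡q⇒line-complement m≡q t≡q in ℓ , inj₁ S⇔off-ℓ)
  ... | no t≢q with Fin.any? (λ l → ∣ S ∩ l ∣ ≟ 0)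
  ...   | yes (ℓ , ∣S∩ℓ∣≡0) = inj₂ (m≡q⇒zero-line⇒affine m≡q ℓ ∣S∩ℓ∣≡0)
  ...   | no no-zero-line   = inj₁ (Baer.baer-complement m≡q t≢q λ l ∣S∩l∣≡0 → no-zero-line (l , ∣S∩l∣≡0))

proposition2p11 : ∀ {np nl} (I : Incidence np nl) (q m t : ℕ) (S : Fin np → Bool) →
    IsProjectivePlane I q → IsGenKMArc I q m t S →
    (t ≡ suc q → IsLine I S) ×
    (t ≡ q → IsConcurrentLinesMinusPoint I m S) ×
    (m ≡ suc q → IsPointComplement I S) ×
    (m ≡ q → IsPrimePower q → IsBaerComplement I q S ⊎ IsAffineMinusAtMostOnePoint I S) ×
    (m ≡ 1 → IsSubsetOfLine I S)
proposition2p11 I q m t S plane arc =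
  t≡q+1⇒line , t≡q⇒concurrent-lines , m≡q+1⇒point-complement , (λ m≡q _ → m≡q⇒baer-or-affine m≡q) , m≡1⇒subset-of-line
  where open GeneralizedKMArc I q m t S plane arc
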